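{- Let $w$ be a finite word over the positive integers. Then $12w\equiv w12$ if and only if the columns of $P(w)$ satisfy both of the following: (a) every column of length $1$ is either a singleton $1$-column or a singleton $2$-column, and if there is any column of length $1$ then both a singleton $1$-column and a singleton $2$-column exist; (b) every column of length at least $2$ contains both an entry $1$ and an entry $2$.
   Context: $P(v)$ is the RSK insertion tableau of $v$ and $\equiv$ is Knuth equivalence ($v\equiv w$ iff $P(v)=P(w)$). A singleton $a$-column of a tableau is a column of length $1$ whose single entry is $a$. -}

module Defs where

open import Data.Nat using (ℕ; zero; suc; _≤_; _<ᵇ_)
open import Data.List using (List; []; _∷_; length; map; mapMaybe; upTo; foldl)
open import Data.Maybe using (Maybe; just; nothing)
open import Data.Product using (_×_; _,_; ∃-syntax)
open import Data.Sum using (_⊎_)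
open import Data.Bool using (if_then_else_)
open import Data.List.Membership.Propositional using (_∈_)
open import Relation.Binary.PropositionalEquality using (_≡_)

-- A word is a list of letters; a tableau is a list of rows (top row first).
Word : Set
Word = List ℕ

Tableau : Set
Tableau = List (List ℕ)

insertRow : ℕ → List ℕ → List ℕ × Maybe ℕ
insertRow x [] = (x ∷ [] , nothing)
insertRow x (y ∷ ys) with x <ᵇ y
... | Data.Bool.true  = (x ∷ ys , just y)
... | Data.Bool.false with insertRow x ys
...   | (r , b) = (y ∷ r , b)

insert : ℕ → Tableau → Tableau
insert x [] = (x ∷ []) ∷ []
insert x (r ∷ rs) with insertRow x r
... | (r' , nothing) = r' ∷ rs
... | (r' , just y)  = r' ∷ insert y rs

P : Word → Tableau
P w = foldl (λ T x → insert x T) [] w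

_≡K_ : Word → Word → Set
v ≡K w = P v ≡ P w

nth : List ℕ → ℕ → Maybe ℕ
nth [] _ = nothing
nth (x ∷ xs) zero = just x
nth (x ∷ xs) (suc j) = nth xs j

firstRowLength : Tableau → ℕ
firstRowLength [] = 0
firstRowLength (r ∷ _) = length r

column : Tableau → ℕ → List ℕ
column T j = mapMaybe (λ r → nth r j) T

columns : Tableau → List (List ℕ)
columns T = map (column T) (upTo (firstRowLength T))

CondA : Tableau → Set
CondA T =
  (∀ c → c ∈ columns T → length c ≡ 1 → (c ≡ 1 ∷ []) ⊎ (c ≡ 2 ∷ []))
  × ((∃[ c ] (c ∈ columns T × length c ≡ 1)) →
       ((1 ∷ []) ∈ columns T) × ((2 ∷ []) ∈ columns T))

CondB : Tableau → Set
CondB T = ∀ c → c ∈ columns T → 2 ≤ length c → (1 ∈ c) × (2 ∈ c)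

module Submission where

-- Rows are handled through their counting functions t ↦ #{entries ≤ t}: a weakly
-- increasing row is determined by its counting function, and inserting x into a row
-- adds a unit step at x and removes one at the bumped letter.  Let a, b be the first
-- two rows of T = P(w).  Then S = P(12w) agrees with T from the third row on, its
-- first row is a + {1, x} and its second row is b + {2} − {x}, where x − 1 is the
-- least t ≥ 1 with #{b ≤ t + 1} = #{a ≤ t} (and x is absent if there is no such t).
-- This relation is preserved when the same letter y ≥ 1 is inserted into both
-- tableaux.  Comparing S with insert 2 (insert 1 T), which has the same size, shows
-- that they are equal exactly when a = 1^α 2^β and b = 2^γ with either γ = α, β = 0
-- or γ < α, β ≥ 1; for a semistandard T with positive entries this is the stated
-- condition on the columns.

open import Defs
open import Data.Nat
open import Data.Nat.Properties
open import Data.Nat.Tactic.RingSolver using (solve-∀)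
open import Data.Bool using (true; false)
open import Data.List using (List; []; _∷_; length; _++_; mapMaybe; foldl; replicate)
open import Data.Nat.ListAction using (sum)
open import Data.List.Properties using (foldl-++; length-replicate; ∷-injectiveˡ)
open import Data.List.Relation.Unary.All as All using (All; []; _∷_)
open import Data.List.Relation.Unary.All.Properties using (++⁺; replicate⁺)
open import Data.List.Relation.Unary.AllPairs using (AllPairs; []; _∷_)
open import Data.List.Relation.Unary.Any using (here; there)
open import Data.List.Membership.Propositional using (_∈_)
open import Data.List.Membership.Propositional.Properties using (∈-map⁺; ∈-map⁻; ∈-upTo⁺; ∈-upTo⁻)
open import Data.Maybe using (Maybe; just; nothing)
open import Data.Maybe.Properties using (just-injective)
open import Data.Product using (_×_; _,_; proj₁; proj₂; Σ; ∃-syntax)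
open import Data.Sum using (_⊎_; inj₁; inj₂; [_,_]′)
open import Data.Empty using (⊥; ⊥-elim)
open import Data.Unit using (⊤; tt)
open import Relation.Nullary using (¬_; yes; no)
open import Relation.Nullary.Reflects using (ofʸ; ofⁿ)
open import Relation.Binary.PropositionalEquality
open import Relation.Binary.Definitions using (tri<; tri≈; tri>)
open import Function.Bundles using (_⇔_; mk⇔)

-- Counting functions

Sorted : List ℕ → Set
Sorted = AllPairs _≤_

-- Opaque, so that unification can read a row r off count r t and a letter z off step z t.
opaque

  step : ℕ → ℕ → ℕ
  step a t with a ≤? t
  ... | yes _ = 1
  ... | no _ = 0

  step-on : ∀ {a t} → a ≤ t → step a t ≡ 1
  step-on {a} {t} a≤t with a ≤? t
  ... | yes _ = refl
  ... | no a≰t = ⊥-elim (a≰t a≤t)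

  step-off : ∀ {a t} → t < a → step a t ≡ 0
  step-off {a} {t} t<a with a ≤? t
  ... | yes a≤t = ⊥-elim (<⇒≱ t<a a≤t)
  ... | no _ = refl

  step-mono : ∀ a {s t} → s ≤ t → step a s ≤ step a t
  step-mono a {s} s≤t with a ≤? s
  ... | no _ = z≤n
  ... | yes a≤s rewrite step-on (≤-trans a≤s s≤t) = ≤-refl

  step≤1 : ∀ a t → step a t ≤ 1
  step≤1 a t with a ≤? t
  ... | yes _ = ≤-refl
  ... | no _ = z≤n

  count : List ℕ → ℕ → ℕ
  count [] t = 0
  count (x ∷ xs) t = step x t + count xs t

  count-[] : ∀ t → count [] t ≡ 0
  count-[] t = refl

  count-∷ : ∀ x xs t → count (x ∷ xs) t ≡ step x t + count xs t
  count-∷ x xs t = refl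

  count-mono : ∀ r {s t} → s ≤ t → count r s ≤ count r t
  count-mono [] _ = z≤n
  count-mono (x ∷ r) s≤t = +-mono-≤ (step-mono x s≤t) (count-mono r s≤t)

  count-below : ∀ {a} xs {t} → All (a ≤_) xs → t < a → count xs t ≡ 0
  count-below [] _ _ = refl
  count-below (x ∷ xs) (a≤x ∷ ps) t<a rewrite step-off (<-≤-trans t<a a≤x) = count-below xs ps t<a

  count≡0⇒All> : ∀ r {t} → count r t ≡ 0 → All (t <_) r
  count≡0⇒All> [] _ = []
  count≡0⇒All> (x ∷ r) {t} eq with x ≤? t
  ... | yes _ = ⊥-elim (1+n≢0 eq)
  ... | no x≰t = ≰⇒> x≰t ∷ count≡0⇒All> r eq

  count-All≤ : ∀ r {t} → All (_≤ t) r → count r t ≡ length r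
  count-All≤ [] _ = refl
  count-All≤ (x ∷ r) (x≤t ∷ ps) rewrite step-on x≤t = cong suc (count-All≤ r ps)

  count-++ : ∀ xs ys t → count (xs ++ ys) t ≡ count xs t + count ys t
  count-++ [] ys t = refl
  count-++ (x ∷ xs) ys t = trans (cong (step x t +_) (count-++ xs ys t)) (sym (+-assoc (step x t) _ _))

  count-replicate : ∀ n v t → count (replicate n v) t ≡ n * step v t
  count-replicate zero v t = refl
  count-replicate (suc n) v t = cong (step v t +_) (count-replicate n v t)

  count-head : ∀ {x} xs → count (x ∷ xs) x ≥ 1
  count-head {x} xs rewrite step-on (≤-refl {x}) = s≤s z≤n

  count-injective : ∀ {r s} → Sorted r → Sorted s → (∀ t → count r t ≡ count s t) → r ≡ s
  count-injective [] [] eq = refl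
  count-injective [] (_∷_ {y} {ys} _ _) eq = ⊥-elim (<⇒≢ (count-head ys) (eq y))
  count-injective (_∷_ {x} {xs} _ _) [] eq = ⊥-elim (<⇒≢ (count-head xs) (sym (eq x)))
  count-injective (_∷_ {x} {xs} p q) (_∷_ {y} {ys} p' q') eq with <-cmp x y
  ... | tri< x<y _ _ = ⊥-elim (<⇒≢ (count-head xs) (sym (trans (eq x) (trans (cong (_+ count ys x) (step-off x<y)) (count-below ys p' x<y)))))
  ... | tri> _ _ y<x = ⊥-elim (<⇒≢ (count-head ys) (trans (sym (trans (cong (_+ count xs y) (step-off y<x)) (count-below xs p y<x))) (eq y)))
  ... | tri≈ _ refl _ = cong (x ∷_) (count-injective q q' (λ t → +-cancelˡ-≡ (step x t) _ _ (eq t)))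

stepᵐ : Maybe ℕ → ℕ → ℕ
stepᵐ nothing t = 0
stepᵐ (just a) t = step a t

stepᵐ-0⊎1 : ∀ m t → stepᵐ m t ≡ 0 ⊎ stepᵐ m t ≡ 1
stepᵐ-0⊎1 nothing t = inj₁ refl
stepᵐ-0⊎1 (just a) t with a ≤? t
... | yes a≤t = inj₂ (step-on a≤t)
... | no a≰t = inj₁ (step-off (≰⇒> a≰t))

-- Inserting x into a row with counting function f bumps the first point after x at
-- which f increases (nothing if f is constant from x on).
Bumps : (ℕ → ℕ) → ℕ → Maybe ℕ → Set
Bumps f x nothing = ∀ t → x ≤ t → f t ≡ f x
Bumps f x (just z) = x < z × (∀ t → x ≤ t → t < z → f t ≡ f x) × f x < f z

Bumps-unique : ∀ f x m m' → Bumps f x m → Bumps f x m' → m ≡ m'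
Bumps-unique f x nothing nothing _ _ = refl
Bumps-unique f x nothing (just z) flat (x<z , _ , jump) = ⊥-elim (<⇒≢ jump (sym (flat z (<⇒≤ x<z))))
Bumps-unique f x (just z) nothing (x<z , _ , jump) flat = ⊥-elim (<⇒≢ jump (sym (flat z (<⇒≤ x<z))))
Bumps-unique f x (just z) (just z') (x<z , flat , jump) (x<z' , flat' , jump') with <-cmp z z'
... | tri< z<z' _ _ = ⊥-elim (<⇒≢ jump (sym (flat' z (<⇒≤ x<z) z<z')))
... | tri≈ _ refl _ = refl
... | tri> _ _ z'<z = ⊥-elim (<⇒≢ jump' (sym (flat z' (<⇒≤ x<z') z'<z)))

Bumps-shift : ∀ f g x k m → (∀ t → x ≤ t → f t ≡ k + g t) → Bumps g x m → Bumps f x m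
Bumps-shift f g x k nothing f≡ flat t x≤t = trans (f≡ t x≤t) (trans (cong (k +_) (flat t x≤t)) (sym (f≡ x ≤-refl)))
Bumps-shift f g x k (just z) f≡ (x<z , flat , jump) =
  x<z , (λ t x≤t t<z → trans (f≡ t x≤t) (trans (cong (k +_) (flat t x≤t t<z)) (sym (f≡ x ≤-refl))))
      , subst₂ _<_ (sym (f≡ x ≤-refl)) (sym (f≡ z (<⇒≤ x<z))) (+-monoʳ-< k jump)

Bumps-flat : ∀ f a m → Bumps f a m → ∀ t → a ≤ t → stepᵐ m t ≡ 0 → f t ≡ f a
Bumps-flat f a nothing flat t a≤t _ = flat t a≤t
Bumps-flat f a (just u) (_ , flat , _) t a≤t off = flat t a≤t (≰⇒> λ u≤t → 1+n≢0 (trans (sym (step-on u≤t)) off))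

Bumps⇒stepᵐ-below : ∀ f z m → Bumps f z m → ∀ t → t ≤ z → stepᵐ m t ≡ 0
Bumps⇒stepᵐ-below f z nothing _ t _ = refl
Bumps⇒stepᵐ-below f z (just u) (z<u , _ , _) t t≤z = step-off (≤-<-trans t≤z z<u)

InsertRowSpec : ℕ → List ℕ → List ℕ × Maybe ℕ → Set
InsertRowSpec x r (r' , m) = Sorted r' × (∀ t → count r' t + stepᵐ m t ≡ count r t + step x t) × Bumps (count r) x m

insertRow-All : ∀ {P : ℕ → Set} x r → P x → All P r → All P (proj₁ (insertRow x r))
insertRow-All x [] px _ = px ∷ []
insertRow-All x (y ∷ ys) px (py ∷ ps) with x <ᵇ y
... | true = px ∷ ps
... | false with insertRow x ys | insertRow-All x ys px ps
...   | (r , b) | h = py ∷ h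

opaque
  unfolding count

  insertRow-spec : ∀ x r → Sorted r → InsertRowSpec x r (insertRow x r)
  insertRow-spec x [] _ = [] ∷ [] , (λ t → trans (+-identityʳ _) (+-identityʳ _)) , (λ t _ → refl)
  insertRow-spec x (y ∷ ys) (y≤ys ∷ sorted) with x <ᵇ y | <ᵇ-reflects-< x y
  ... | true | ofʸ x<y =
    All.map (≤-trans (<⇒≤ x<y)) y≤ys ∷ sorted
    , (λ t → swap-outer (step x t) (count ys t) (step y t))
    , (x<y , (λ t _ t<y → trans (zero-below t t<y) (sym (zero-below x x<y))) , subst (_< count (y ∷ ys) y) (sym (zero-below x x<y)) (count-head ys))
    where
      swap-outer : ∀ p q r → p + q + r ≡ r + q + p
      swap-outer = solve-∀
      zero-below : ∀ t → t < y → count (y ∷ ys) t ≡ 0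
      zero-below t t<y rewrite step-off t<y = count-below ys y≤ys t<y
  ... | false | ofⁿ x≮y with insertRow x ys | insertRow-spec x ys sorted | insertRow-All {y ≤_} x ys (≮⇒≥ x≮y) y≤ys
  ...   | (r , b) | (sorted' , count≡ , bumps) | y≤r =
    y≤r ∷ sorted'
    , (λ t → trans (+-assoc (step y t) _ _) (trans (cong (step y t +_) (count≡ t)) (sym (+-assoc (step y t) _ _))))
    , Bumps-shift (count (y ∷ ys)) (count ys) x 1 b (λ t x≤t → cong (_+ count ys t) (step-on (≤-trans (≮⇒≥ x≮y) x≤t))) bumps

subst-summands : ∀ m n {p q p' q'} → m + p ≡ n + q → p ≡ p' → q ≡ q' → m + p' ≡ n + q'
subst-summands m n eq refl refl = eq

m+0≡n+0⇒m≡n : ∀ {m n} → m + 0 ≡ n + 0 → m ≡ n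
m+0≡n+0⇒m≡n {m} {n} eq = trans (sym (+-identityʳ m)) (trans eq (+-identityʳ n))

m+0≡n+1⇒m≡n+1 : ∀ {m n} → m + 0 ≡ n + 1 → m ≡ n + 1
m+0≡n+1⇒m≡n+1 {m} eq = trans (sym (+-identityʳ m)) eq

m+1≡n+1⇒m≡n : ∀ {m n} → m + 1 ≡ n + 1 → m ≡ n
m+1≡n+1⇒m≡n {m} {n} = +-cancelʳ-≡ 1 m n

-- Tableaux

row₀ : Tableau → List ℕ
row₀ [] = []
row₀ (r ∷ _) = r

dropRow : Tableau → Tableau
dropRow [] = []
dropRow (_ ∷ rs) = rs

row₁ : Tableau → List ℕ
row₁ T = row₀ (dropRow T)

rows₂ : Tableau → Tableau
rows₂ T = dropRow (dropRow T)

split₂ : Tableau → List ℕ × List ℕ × Tableau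
split₂ T = row₀ T , row₁ T , rows₂ T

insertᵐ : Maybe ℕ → Tableau → Tableau
insertᵐ nothing R = R
insertᵐ (just u) R = insert u R

bumpInto : List ℕ × Maybe ℕ → List ℕ → List ℕ × List ℕ × Maybe ℕ
bumpInto (a' , nothing) b = a' , b , nothing
bumpInto (a' , just z) b = a' , insertRow z b

insertRow₂ : ℕ → List ℕ → List ℕ → List ℕ × List ℕ × Maybe ℕ
insertRow₂ y a b = bumpInto (insertRow y a) b

stack₁ : List ℕ × Maybe ℕ → Tableau → List ℕ × Tableau
stack₁ (b' , m) R = b' , insertᵐ m R

stack₂ : List ℕ × List ℕ × Maybe ℕ → Tableau → List ℕ × List ℕ × Tableau
stack₂ (a' , b' , m) R = a' , b' , insertᵐ m R

split₁-insert : ∀ z T → (row₀ (insert z T) , dropRow (insert z T)) ≡ stack₁ (insertRow z (row₀ T)) (dropRow T)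
split₁-insert z [] = refl
split₁-insert z (r ∷ rs) with insertRow z r
... | (r' , nothing) = refl
... | (r' , just u) = refl

split₂-insert : ∀ y T → split₂ (insert y T) ≡ stack₂ (insertRow₂ y (row₀ T) (row₁ T)) (rows₂ T)
split₂-insert y [] = refl
split₂-insert y (r ∷ rs) with insertRow y r
... | (r' , nothing) = refl
... | (r' , just z) = cong (r' ,_) (split₁-insert z rs)

row₀-insert : ∀ z T → row₀ (insert z T) ≡ proj₁ (insertRow z (row₀ T))
row₀-insert z [] = refl
row₀-insert z (r ∷ rs) with insertRow z r
... | (r' , nothing) = refl
... | (r' , just u) = refl

-- Column strictness of two consecutive rows r, s in counting form: the i-th entry of
-- s exceeds the i-th entry of r.
ColumnStrict : List ℕ → List ℕ → Set
ColumnStrict r s = ∀ v → count s (suc v) ≤ count r v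

Semistandard : Tableau → Set
Semistandard [] = ⊤
Semistandard (r ∷ rs) = Sorted r × ColumnStrict r (row₀ rs) × Semistandard rs

sorted₀ : ∀ T → Semistandard T → Sorted (row₀ T)
sorted₀ [] _ = []
sorted₀ (r ∷ rs) (sorted , _) = sorted

sorted₁ : ∀ T → Semistandard T → Sorted (row₁ T)
sorted₁ [] _ = []
sorted₁ (r ∷ rs) (_ , _ , ss) = sorted₀ rs ss

strict₀₁ : ∀ T → Semistandard T → ColumnStrict (row₀ T) (row₁ T)
strict₀₁ [] _ v = ≤-reflexive (trans (count-[] (suc v)) (sym (count-[] v)))
strict₀₁ (r ∷ rs) (_ , r≺s , _) = r≺s

count-grows : ∀ {r r' x} u t → count r' t + stepᵐ u t ≡ count r t + step x t → stepᵐ u t ≡ 0 → count r t ≤ count r' t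
count-grows {r} {r'} {x} u t eq off =
  subst (count r t ≤_) (trans (sym eq) (trans (cong (count r' t +_) off) (+-identityʳ _))) (m≤m+n (count r t) (step x t))

count-shrinks : ∀ {r r' x} u t → count r' t + stepᵐ u t ≡ count r t + step x t → step x t ≡ 0 → count r' t ≤ count r t
count-shrinks {r} {r'} {x} u t eq off =
  subst (count r' t ≤_) (trans eq (trans (cong (count r t +_) off) (+-identityʳ _))) (m≤m+n (count r' t) (stepᵐ u t))

ColumnStrict-insert : ∀ x r r' z s → InsertRowSpec x r (r' , just z) → Sorted s →
                      ColumnStrict r s → ColumnStrict r' (proj₁ (insertRow z s))
ColumnStrict-insert x r r' (suc z') s (_ , r'≡ , (s≤s x≤z' , flat , jump)) sorted-s r≺s
  with insertRow (suc z') s | insertRow-spec (suc z') s sorted-s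
... | (s' , m) | (_ , s'≡ , bumps) = bound
  where
    open ≤-Reasoning
    z = suc z'
    s'≤ : ∀ v → count s' (suc v) ≤ count s (suc v) + step z (suc v)
    s'≤ v = subst (count s' (suc v) ≤_) (s'≡ (suc v)) (m≤m+n _ _)
    r'≡r : ∀ {v} → step z v ≡ step x v → count r' v ≡ count r v
    r'≡r {v} same = +-cancelʳ-≡ (step z v) _ _ (trans (r'≡ v) (cong (count r v +_) (sym same)))
    bound : ∀ v → count s' (suc v) ≤ count r' v
    bound v with v <? x | v <? z
    ... | yes v<x | _ =
      ≤-trans (count-shrinks m (suc v) (s'≡ (suc v)) (step-off (s≤s (≤-trans v<x x≤z'))))
              (≤-trans (r≺s v) (≤-reflexive (sym (r'≡r (trans (step-off (≤-trans v<x (≤-trans x≤z' (n≤1+n z')))) (sym (step-off v<x)))))))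
    ... | no v≮x | yes v<z = begin
      count s' (suc v)                 ≤⟨ s'≤ v ⟩
      count s (suc v) + step z (suc v) ≤⟨ +-mono-≤ (r≺s v) (step≤1 z (suc v)) ⟩
      count r v + 1                    ≡⟨ sym (subst-summands (count r' v) (count r v) (r'≡ v) (step-off v<z) (step-on (≮⇒≥ v≮x))) ⟩
      count r' v + 0                   ≡⟨ +-identityʳ _ ⟩
      count r' v                       ∎
    ... | no v≮x | no v≮z with stepᵐ-0⊎1 m (suc v)
    ...   | inj₂ bumped = begin
      count s' (suc v) ≡⟨ m+1≡n+1⇒m≡n (subst-summands (count s' (suc v)) _ (s'≡ (suc v)) bumped (step-on (≤-trans (≮⇒≥ v≮z) (n≤1+n v)))) ⟩
      count s (suc v)  ≤⟨ r≺s v ⟩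
      count r v        ≡⟨ sym (r'≡r (trans (step-on (≮⇒≥ v≮z)) (sym (step-on (≤-trans x≤z' (≤-trans (n≤1+n z') (≮⇒≥ v≮z))))))) ⟩
      count r' v       ∎
    ...   | inj₁ unbumped = begin
      count s' (suc v)     ≡⟨ m+0≡n+1⇒m≡n+1 (subst-summands (count s' (suc v)) _ (s'≡ (suc v)) unbumped (step-on (≤-trans (≮⇒≥ v≮z) (n≤1+n v)))) ⟩
      count s (suc v) + 1  ≡⟨ cong (_+ 1) (Bumps-flat (count s) z m bumps (suc v) (≤-trans (≮⇒≥ v≮z) (n≤1+n v)) unbumped) ⟩
      count s z + 1        ≤⟨ +-monoˡ-≤ 1 (r≺s z') ⟩
      count r z' + 1       ≡⟨ cong (_+ 1) (flat z' x≤z' ≤-refl) ⟩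
      count r x + 1        ≡⟨ +-comm _ 1 ⟩
      suc (count r x)      ≤⟨ jump ⟩
      count r z            ≤⟨ count-mono r (≮⇒≥ v≮z) ⟩
      count r v            ≡⟨ sym (r'≡r (trans (step-on (≮⇒≥ v≮z)) (sym (step-on (≤-trans x≤z' (≤-trans (n≤1+n z') (≮⇒≥ v≮z))))))) ⟩
      count r' v           ∎

Semistandard-insert : ∀ y T → Semistandard T → Semistandard (insert y T)
Semistandard-insert y [] _ = [] ∷ [] , (λ v → ≤-trans (≤-reflexive (count-[] (suc v))) z≤n) , tt
Semistandard-insert y (r ∷ rs) (sorted , r≺s , ss) with insertRow y r | insertRow-spec y r sorted
... | (r' , nothing) | (sorted' , r'≡ , _) =
  sorted' , (λ v → ≤-trans (r≺s v) (count-grows nothing v (r'≡ v) refl)) , ss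
... | (r' , just z) | spec@(sorted' , _ , _) =
  sorted' , subst (ColumnStrict r') (sym (row₀-insert z rs)) (ColumnStrict-insert y r r' z (row₀ rs) spec (sorted₀ rs ss) r≺s)
  , Semistandard-insert z rs ss

Positive : Tableau → Set
Positive T = count (row₀ T) 0 ≡ 0

Positive-insert : ∀ y T → 1 ≤ y → Semistandard T → Positive T → Positive (insert y T)
Positive-insert y T 1≤y ss pos =
  subst (λ r → count r 0 ≡ 0) (sym (row₀-insert y T)) (no-zero (insertRow y (row₀ T)) (insertRow-spec y (row₀ T) (sorted₀ T ss)))
  where
    no-zero : ∀ p → InsertRowSpec y (row₀ T) p → count (proj₁ p) 0 ≡ 0
    no-zero (r' , m) (_ , r'≡ , _) = m+n≡0⇒m≡0 (count r' 0) (trans (r'≡ 0) (trans (cong (_+ step y 0) pos) (step-off 1≤y)))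

NonEmptyRows : Tableau → Set
NonEmptyRows T = All (λ r → 0 < length r) T

insertRow-nonEmpty : ∀ x r → 0 < length (proj₁ (insertRow x r))
insertRow-nonEmpty x [] = s≤s z≤n
insertRow-nonEmpty x (y ∷ ys) with x <ᵇ y
... | true = s≤s z≤n
... | false with insertRow x ys
...   | (r , b) = s≤s z≤n

NonEmptyRows-insert : ∀ y T → NonEmptyRows T → NonEmptyRows (insert y T)
NonEmptyRows-insert y [] _ = s≤s z≤n ∷ []
NonEmptyRows-insert y (r ∷ rs) (_ ∷ ne) with insertRow y r | insertRow-nonEmpty y r
... | (r' , nothing) | ne' = ne' ∷ ne
... | (r' , just z) | ne' = ne' ∷ NonEmptyRows-insert z rs ne

split₂-injective : ∀ T U → NonEmptyRows T → NonEmptyRows U → split₂ T ≡ split₂ U → T ≡ U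
split₂-injective [] [] _ _ _ = refl
split₂-injective [] (r ∷ U) _ (ne ∷ _) eq = ⊥-elim (<⇒≢ ne (cong (λ p → length (proj₁ p)) eq))
split₂-injective (r ∷ T) [] (ne ∷ _) _ eq = ⊥-elim (<⇒≢ ne (cong (λ p → length (proj₁ p)) (sym eq)))
split₂-injective (r ∷ []) (r' ∷ []) _ _ eq = cong (_∷ []) (cong proj₁ eq)
split₂-injective (r ∷ []) (r' ∷ s ∷ U) _ (_ ∷ ne ∷ _) eq = ⊥-elim (<⇒≢ ne (cong (λ p → length (proj₁ (proj₂ p))) eq))
split₂-injective (r ∷ s ∷ T) (r' ∷ []) (_ ∷ ne ∷ _) _ eq = ⊥-elim (<⇒≢ ne (cong (λ p → length (proj₁ (proj₂ p))) (sym eq)))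
split₂-injective (r ∷ s ∷ T) (r' ∷ s' ∷ U) _ _ eq =
  cong₂ _∷_ (cong proj₁ eq) (cong₂ _∷_ (cong (λ p → proj₁ (proj₂ p)) eq) (cong (λ p → proj₂ (proj₂ p)) eq))

weight : Maybe ℕ → ℕ
weight nothing = 0
weight (just _) = 1

insertRow-length : ∀ x r → length (proj₁ (insertRow x r)) + weight (proj₂ (insertRow x r)) ≡ suc (length r)
insertRow-length x [] = refl
insertRow-length x (y ∷ ys) with x <ᵇ y
... | true = +-comm _ 1
... | false with insertRow x ys | insertRow-length x ys
...   | (r , b) | len = cong suc len

size : Tableau → ℕ
size [] = 0
size (r ∷ rs) = length r + size rs

size-insert : ∀ u R → size (insert u R) ≡ suc (size R)
size-insert u [] = refl
size-insert u (r ∷ rs) with insertRow u r | insertRow-length u r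
... | (r' , nothing) | len = cong (_+ size rs) (trans (sym (+-identityʳ _)) len)
... | (r' , just z) | len = begin
  length r' + size (insert z rs) ≡⟨ cong (length r' +_) (size-insert z rs) ⟩
  length r' + suc (size rs)      ≡⟨ +-suc _ _ ⟩
  suc (length r' + size rs)      ≡⟨ cong (λ k → suc (k + size rs)) (m+1≡n+1⇒m≡n (trans len (+-comm 1 _))) ⟩
  suc (length r + size rs)       ∎
  where open ≡-Reasoning

size-insertᵐ : ∀ m R → size (insertᵐ m R) ≡ weight m + size R
size-insertᵐ nothing R = refl
size-insertᵐ (just u) R = size-insert u R

insertᵐ²-fixed⇒nothing : ∀ m₁ m₂ R → R ≡ insertᵐ m₂ (insertᵐ m₁ R) → m₁ ≡ nothing × m₂ ≡ nothing
insertᵐ²-fixed⇒nothing m₁ m₂ R eq =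
  weights (trans (cong size eq) (trans (size-insertᵐ m₂ _) (cong (weight m₂ +_) (size-insertᵐ m₁ R))))
  where
    weights : ∀ {m₁ m₂} → size R ≡ weight m₂ + (weight m₁ + size R) → m₁ ≡ nothing × m₂ ≡ nothing
    weights {nothing} {nothing} _ = refl , refl
    weights {just _} {nothing} eq = ⊥-elim (<⇒≢ (n<1+n _) eq)
    weights {nothing} {just _} eq = ⊥-elim (<⇒≢ (n<1+n _) eq)
    weights {just _} {just _} eq = ⊥-elim (<⇒≢ (≤-trans (n<1+n (size R)) (n≤1+n _)) eq)

InsertRowᵐSpec : Maybe ℕ → List ℕ → List ℕ → Maybe ℕ → Set
InsertRowᵐSpec nothing b b' m = b' ≡ b × m ≡ nothing
InsertRowᵐSpec (just z) b b' m = Bumps (count b) z m × (∀ t → count b' t + stepᵐ m t ≡ count b t + step z t)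

-- Insertion₂ y a b z a' b' m: inserting y into the rows a, b bumps z from a into b,
-- which gives the rows a', b' and bumps m out of b.
record Insertion₂ (y : ℕ) (a b : List ℕ) (z : Maybe ℕ) (a' b' : List ℕ) (m : Maybe ℕ) : Set where
  constructor ins₂
  field
    bumps₀ : Bumps (count a) y z
    count₀ : ∀ t → count a' t + stepᵐ z t ≡ count a t + step y t
    into₁  : InsertRowᵐSpec z b b' m

InsertRow₂Spec : ℕ → List ℕ → List ℕ → List ℕ × List ℕ × Maybe ℕ → Set
InsertRow₂Spec y a b (a' , b' , m) = Sorted a' × Sorted b' × Σ (Maybe ℕ) λ z → Insertion₂ y a b z a' b' m

insertRow₂-spec : ∀ y a b → Sorted a → Sorted b → InsertRow₂Spec y a b (insertRow₂ y a b)
insertRow₂-spec y a b sorted-a sorted-b with insertRow y a | insertRow-spec y a sorted-a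
... | (a' , nothing) | (sorted-a' , count-a' , bumps-a) = sorted-a' , sorted-b , nothing , ins₂ bumps-a count-a' (refl , refl)
... | (a' , just z) | (sorted-a' , count-a' , bumps-a) with insertRow z b | insertRow-spec z b sorted-b
...   | (b' , m) | (sorted-b' , count-b' , bumps-b) = sorted-a' , sorted-b' , just z , ins₂ bumps-a count-a' (bumps-b , count-b')

-- The relation between the first two rows of P(12w) and P(w)

Slack : List ℕ → List ℕ → ℕ → Set
Slack a b t = count b (suc t) < count a t

FirstTight : List ℕ → List ℕ → Maybe ℕ → Set
FirstTight a b nothing = ∀ t → 1 ≤ t → Slack a b t
FirstTight a b (just x) =
  Σ ℕ λ x' → x ≡ suc x' × 1 ≤ x' × count b (suc x') ≡ count a x' × (∀ t → 1 ≤ t → t < x' → Slack a b t)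

FirstTight-unique : ∀ a b x x' → FirstTight a b x → FirstTight a b x' → x ≡ x'
FirstTight-unique a b nothing nothing _ _ = refl
FirstTight-unique a b nothing (just _) slack (x₁ , refl , 1≤x₁ , tight , _) = ⊥-elim (<⇒≢ (slack x₁ 1≤x₁) tight)
FirstTight-unique a b (just _) nothing (x₁ , refl , 1≤x₁ , tight , _) slack = ⊥-elim (<⇒≢ (slack x₁ 1≤x₁) tight)
FirstTight-unique a b (just _) (just _) (x₁ , refl , 1≤x₁ , tight₁ , slack₁) (x₂ , refl , 1≤x₂ , tight₂ , slack₂)
  with <-cmp x₁ x₂
... | tri< x₁<x₂ _ _ = ⊥-elim (<⇒≢ (slack₂ x₁ 1≤x₁ x₁<x₂) tight₁)
... | tri≈ _ refl _ = refl
... | tri> _ _ x₂<x₁ = ⊥-elim (<⇒≢ (slack₁ x₂ 1≤x₂ x₂<x₁) tight₂)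

Row₀Rel : List ℕ → List ℕ → Maybe ℕ → Set
Row₀Rel s₀ a x = ∀ t → count s₀ t ≡ step 1 t + (count a t + stepᵐ x t)

Row₁Rel : List ℕ → List ℕ → Maybe ℕ → Set
Row₁Rel s₁ b x = ∀ t → count s₁ t + stepᵐ x t ≡ count b t + step 2 t

Rel12 : List ℕ → List ℕ → List ℕ → List ℕ → Set
Rel12 s₀ s₁ a b = Σ (Maybe ℕ) λ x → FirstTight a b x × Row₀Rel s₀ a x × Row₁Rel s₁ b x

Related₂ : List ℕ × List ℕ × Maybe ℕ → List ℕ × List ℕ × Maybe ℕ → Set
Related₂ (s₀ , s₁ , m₁) (a , b , m) = Rel12 s₀ s₁ a b × m₁ ≡ m

Row₀Rel-same : ∀ {s₀ s₀' a a' z} x u → Row₀Rel s₀ a x →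
  (∀ t → count s₀' t + stepᵐ u t ≡ count s₀ t + step z t) → (∀ t → count a' t + stepᵐ u t ≡ count a t + step z t) →
  Row₀Rel s₀' a' x
Row₀Rel-same {s₀} {s₀'} {a} {a'} {z} x u rel eq-s eq-a t = +-cancelʳ-≡ (stepᵐ u t) _ _ (begin
  count s₀' t + stepᵐ u t                      ≡⟨ eq-s t ⟩
  count s₀ t + step z t                        ≡⟨ cong (_+ step z t) (rel t) ⟩
  step 1 t + (count a t + stepᵐ x t) + step z t ≡⟨ shuffle (step 1 t) (count a t) (stepᵐ x t) (step z t) ⟩
  step 1 t + stepᵐ x t + (count a t + step z t) ≡⟨ cong (step 1 t + stepᵐ x t +_) (sym (eq-a t)) ⟩
  step 1 t + stepᵐ x t + (count a' t + stepᵐ u t) ≡⟨ unshuffle (step 1 t) (stepᵐ x t) (count a' t) (stepᵐ u t) ⟩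
  step 1 t + (count a' t + stepᵐ x t) + stepᵐ u t ∎)
  where
    open ≡-Reasoning
    shuffle : ∀ i c g k → i + (c + g) + k ≡ i + g + (c + k)
    shuffle = solve-∀
    unshuffle : ∀ i g c k → i + g + (c + k) ≡ i + (c + g) + k
    unshuffle = solve-∀

Row₁Rel-same : ∀ {s₁ s₁' b b' z} x u → Row₁Rel s₁ b x →
  (∀ t → count s₁' t + stepᵐ u t ≡ count s₁ t + step z t) → (∀ t → count b' t + stepᵐ u t ≡ count b t + step z t) →
  Row₁Rel s₁' b' x
Row₁Rel-same {s₁} {s₁'} {b} {b'} {z} x u rel eq-s eq-b t = +-cancelʳ-≡ (stepᵐ u t) _ _ (begin
  count s₁' t + stepᵐ x t + stepᵐ u t ≡⟨ swap₂₃ (count s₁' t) (stepᵐ x t) (stepᵐ u t) ⟩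
  count s₁' t + stepᵐ u t + stepᵐ x t ≡⟨ cong (_+ stepᵐ x t) (eq-s t) ⟩
  count s₁ t + step z t + stepᵐ x t   ≡⟨ swap₂₃ (count s₁ t) (step z t) (stepᵐ x t) ⟩
  count s₁ t + stepᵐ x t + step z t   ≡⟨ cong (_+ step z t) (rel t) ⟩
  count b t + step 2 t + step z t     ≡⟨ swap₂₃ (count b t) (step 2 t) (step z t) ⟩
  count b t + step z t + step 2 t     ≡⟨ cong (_+ step 2 t) (sym (eq-b t)) ⟩
  count b' t + stepᵐ u t + step 2 t   ≡⟨ swap₂₃ (count b' t) (stepᵐ u t) (step 2 t) ⟩
  count b' t + step 2 t + stepᵐ u t   ∎)
  where
    open ≡-Reasoning
    swap₂₃ : ∀ p q r → p + q + r ≡ p + r + q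
    swap₂₃ = solve-∀

Row₀Rel-swap : ∀ {s₀ s₀' a a' z} x u → Row₀Rel s₀ a x →
  (∀ t → count s₀' t + stepᵐ x t ≡ count s₀ t + step z t) → (∀ t → count a' t + stepᵐ u t ≡ count a t + step z t) →
  Row₀Rel s₀' a' u
Row₀Rel-swap {s₀} {s₀'} {a} {a'} {z} x u rel eq-s eq-a t = +-cancelʳ-≡ (stepᵐ x t) _ _ (begin
  count s₀' t + stepᵐ x t                       ≡⟨ eq-s t ⟩
  count s₀ t + step z t                         ≡⟨ cong (_+ step z t) (rel t) ⟩
  step 1 t + (count a t + stepᵐ x t) + step z t ≡⟨ shuffle (step 1 t) (count a t) (stepᵐ x t) (step z t) ⟩
  step 1 t + (count a t + step z t) + stepᵐ x t ≡⟨ cong (λ k → step 1 t + k + stepᵐ x t) (sym (eq-a t)) ⟩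
  step 1 t + (count a' t + stepᵐ u t) + stepᵐ x t ∎)
  where
    open ≡-Reasoning
    shuffle : ∀ i c g k → i + (c + g) + k ≡ i + (c + k) + g
    shuffle = solve-∀

Row₁Rel-swap : ∀ {s₁ s₁' b b'} x u m → Row₁Rel s₁ b x →
  (∀ t → count s₁' t + stepᵐ m t ≡ count s₁ t + stepᵐ x t) → (∀ t → count b' t + stepᵐ m t ≡ count b t + stepᵐ u t) →
  Row₁Rel s₁' b' u
Row₁Rel-swap {s₁} {s₁'} {b} {b'} x u m rel eq-s eq-b t = +-cancelʳ-≡ (stepᵐ m t) _ _ (begin
  count s₁' t + stepᵐ u t + stepᵐ m t ≡⟨ swap₂₃ (count s₁' t) (stepᵐ u t) (stepᵐ m t) ⟩
  count s₁' t + stepᵐ m t + stepᵐ u t ≡⟨ cong (_+ stepᵐ u t) (trans (eq-s t) (rel t)) ⟩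
  count b t + step 2 t + stepᵐ u t    ≡⟨ swap₂₃ (count b t) (step 2 t) (stepᵐ u t) ⟩
  count b t + stepᵐ u t + step 2 t    ≡⟨ cong (_+ step 2 t) (sym (eq-b t)) ⟩
  count b' t + stepᵐ m t + step 2 t   ≡⟨ swap₂₃ (count b' t) (stepᵐ m t) (step 2 t) ⟩
  count b' t + step 2 t + stepᵐ m t   ∎)
  where
    open ≡-Reasoning
    swap₂₃ : ∀ p q r → p + q + r ≡ p + r + q
    swap₂₃ = solve-∀

Bumps-extend : ∀ f {X z} m → X ≤ z → (∀ t → X ≤ t → t ≤ z → f t ≡ f X) → Bumps f z m → Bumps f X m
Bumps-extend f {X} {z} nothing X≤z early flat t X≤t with t ≤? z
... | yes t≤z = early t X≤t t≤z
... | no t≰z = trans (flat t (<⇒≤ (≰⇒> t≰z))) (early z X≤z ≤-refl)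
Bumps-extend f {X} {z} (just u) X≤z early (z<u , flat , jump) = ≤-<-trans X≤z z<u , flat' , subst (_< f u) (early z X≤z ≤-refl) jump
  where
    flat' : ∀ t → X ≤ t → t < u → f t ≡ f X
    flat' t X≤t t<u with t ≤? z
    ... | yes t≤z = early t X≤t t≤z
    ... | no t≰z = trans (flat t (<⇒≤ (≰⇒> t≰z)) t<u) (early z X≤z ≤-refl)

2+m≤n⇒n≢m : ∀ {m n} → suc (suc m) ≤ n → n ≡ m → ⊥
2+m≤n⇒n≢m 2+m≤n refl = <⇒≱ (≤-trans (n≤1+n _) 2+m≤n) ≤-refl

FirstTight-transport : ∀ {a b a' b' x'} → (∀ t → t ≤ x' → count a' t ≡ count a t) →
  (∀ t → t ≤ x' → count b' (suc t) ≡ count b (suc t)) → FirstTight a b (just (suc x')) → FirstTight a' b' (just (suc x'))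
FirstTight-transport same-a same-b (x' , refl , 1≤x' , tight , slack) =
  x' , refl , 1≤x' , trans (same-b x' ≤-refl) (trans tight (sym (same-a x' ≤-refl)))
  , λ t 1≤t t<x' → subst₂ _<_ (sym (same-b t (<⇒≤ t<x'))) (sym (same-a t (<⇒≤ t<x'))) (slack t 1≤t t<x')

module Insertion12 (y : ℕ) (1≤y : 1 ≤ y) {a b s₀ s₁ : List ℕ} (a≺b : ColumnStrict a b) where

  A B : ℕ → ℕ
  A = count a
  B = count b

  Result : List ℕ → List ℕ → Maybe ℕ → List ℕ → List ℕ → Maybe ℕ → Set
  Result s₀' s₁' m₁ a' b' m = Related₂ (s₀' , s₁' , m₁) (a' , b' , m)

  S-bumps : ∀ {z} x → y < z → (∀ t → y ≤ t → t < z → A t ≡ A y) → (∀ t → t < z → stepᵐ x t ≡ 0) →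
            A y < A z + stepᵐ x z → Row₀Rel s₀ a x → Bumps (count s₀) y (just z)
  S-bumps {z} x y<z flat off jump rel₀ = y<z , flat₀ , jump₀
    where
      at-y : count s₀ y ≡ 1 + (A y + 0)
      at-y = trans (rel₀ y) (cong₂ (λ p q → p + (A y + q)) (step-on 1≤y) (off y y<z))
      flat₀ : ∀ t → y ≤ t → t < z → count s₀ t ≡ count s₀ y
      flat₀ t y≤t t<z = trans (rel₀ t) (trans (evaluate (step-on (≤-trans 1≤y y≤t)) (flat t y≤t t<z) (off t t<z)) (sym at-y))
        where
          evaluate : ∀ {p q r} → p ≡ 1 → q ≡ A y → r ≡ 0 → p + (q + r) ≡ 1 + (A y + 0)
          evaluate refl refl refl = refl
      jump₀ : count s₀ y < count s₀ z
      jump₀ = subst₂ _<_ (sym at-y) (sym (trans (rel₀ z) (cong (_+ (A z + stepᵐ x z)) (step-on (≤-trans 1≤y (<⇒≤ y<z))))))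
                (s≤s (subst (_< A z + stepᵐ x z) (sym (+-identityʳ (A y))) jump))

  B-flat-after-tight : ∀ {x' n} → B (suc x') ≡ A x' → (∀ t → x' ≤ t → t < n → A t ≡ A x') →
                       ∀ t → suc x' ≤ t → t ≤ n → B t ≡ B (suc x')
  B-flat-after-tight tight flat (suc t) (s≤s x'≤t) t<n =
    ≤-antisym (≤-trans (a≺b t) (≤-reflexive (trans (flat t x'≤t t<n) (sym tight)))) (count-mono b (s≤s x'≤t))

  B-flat-until-bump : ∀ {x' z} → FirstTight a b (just (suc x')) → y ≤ x' → Bumps A y (just z) → suc x' < z →
                      ∀ t → suc x' ≤ t → t ≤ z → B t ≡ B (suc x')
  B-flat-until-bump {x'} (_ , refl , _ , tight , _) y≤x' (_ , flat , _) X<z =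
    B-flat-after-tight tight (λ t x'≤t t<z → trans (flat t (≤-trans y≤x' x'≤t) t<z) (sym (flat x' y≤x' (<-trans (n<1+n x') X<z))))

  below-tight-jump : ∀ {X} → y ≤ X → A y < A X + step X X
  below-tight-jump {X} y≤X = subst (λ k → A y < A X + k) (sym (step-on ≤-refl)) (≤-<-trans (count-mono a y≤X) (m<m+n (A X) z<s))

  slack-after-bump : ∀ {z a' b' m} → Bumps A y (just z) → (∀ t → count a' t + step z t ≡ A t + step y t) →
    Bumps B z m → (∀ t → count b' t + stepᵐ m t ≡ B t + step z t) →
    ∀ t → 1 ≤ t → (∀ s → 1 ≤ s → s ≤ t → Slack a b s) → Slack a' b' t
  slack-after-bump {suc z'} {a'} {b'} {m} (s≤s y≤z' , flat , jump) eA bB eB t 1≤t slack with <-cmp (suc t) (suc z')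
  ... | tri< t<z _ _ = begin-strict
    count b' (suc t) ≤⟨ count-shrinks m (suc t) (eB (suc t)) (step-off t<z) ⟩
    B (suc t)        <⟨ slack t 1≤t ≤-refl ⟩
    A t              ≤⟨ count-grows (just _) t (eA t) (step-off (<-trans (n<1+n t) t<z)) ⟩
    count a' t       ∎
    where open ≤-Reasoning
  ... | tri≈ _ refl _ = subst₂ _<_ (sym b'≡) (sym a'≡) (+-monoˡ-< 1 (slack t 1≤t ≤-refl))
    where
      a'≡ : count a' t ≡ A t + 1
      a'≡ = m+0≡n+1⇒m≡n+1 (subst-summands (count a' t) (A t) (eA t) (step-off (n<1+n t)) (step-on y≤z'))
      b'≡ : count b' (suc t) ≡ B (suc t) + 1
      b'≡ = m+0≡n+1⇒m≡n+1 (subst-summands (count b' (suc t)) (B (suc t)) (eB (suc t)) (Bumps⇒stepᵐ-below B (suc t) m bB (suc t) ≤-refl) (step-on ≤-refl))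
  ... | tri> _ _ (s≤s z≤t) = by-bump (stepᵐ-0⊎1 m (suc t))
    where
      open ≤-Reasoning
      a'≡ : count a' t ≡ A t
      a'≡ = m+1≡n+1⇒m≡n (subst-summands (count a' t) (A t) (eA t) (step-on z≤t) (step-on (≤-trans y≤z' (≤-trans (n≤1+n z') z≤t))))
      b'-eq : ∀ {k} → stepᵐ m (suc t) ≡ k → count b' (suc t) + k ≡ B (suc t) + 1
      b'-eq refl = subst-summands (count b' (suc t)) (B (suc t)) (eB (suc t)) refl (step-on (≤-trans z≤t (n≤1+n t)))
      by-bump : stepᵐ m (suc t) ≡ 0 ⊎ stepᵐ m (suc t) ≡ 1 → Slack a' b' t
      by-bump (inj₂ bumped) = subst₂ _<_ (sym (m+1≡n+1⇒m≡n (b'-eq bumped))) (sym a'≡) (slack t 1≤t ≤-refl)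
      by-bump (inj₁ unbumped) = begin-strict
        count b' (suc t) ≡⟨ m+0≡n+1⇒m≡n+1 (b'-eq unbumped) ⟩
        B (suc t) + 1    ≡⟨ cong (_+ 1) (Bumps-flat B (suc z') m bB (suc t) (≤-trans z≤t (n≤1+n t)) unbumped) ⟩
        B (suc z') + 1   ≡⟨ +-comm _ 1 ⟩
        suc (B (suc z')) ≤⟨ slack z' (≤-trans 1≤y y≤z') (≤-trans (n≤1+n z') z≤t) ⟩
        A z'             ≡⟨ flat z' y≤z' ≤-refl ⟩
        A y              <⟨ jump ⟩
        A (suc z')       ≤⟨ count-mono a z≤t ⟩
        A t              ≡⟨ sym a'≡ ⟩
        count a' t       ∎

  slack-gained : ∀ {x' a'} → (∀ t → 1 ≤ t → t < x' → Slack a b t) → y ≤ x' →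
                 ∀ t → 1 ≤ t → count a' t + 0 ≡ A t + step y t → Slack a' b t
  slack-gained {x'} {a'} slack y≤x' t 1≤t eq with t <? x'
  ... | yes t<x' = <-≤-trans (slack t 1≤t t<x') (count-grows nothing t eq refl)
  ... | no t≮x' = subst (B (suc t) <_) (sym a'≡) (≤-<-trans (a≺b t) (m<m+n (A t) z<s))
    where
      a'≡ : count a' t ≡ A t + 1
      a'≡ = m+0≡n+1⇒m≡n+1 (subst-summands (count a' t) (A t) eq refl (step-on (≤-trans y≤x' (≮⇒≥ t≮x'))))

  gap-before-tight : ∀ {x' z} → FirstTight a b (just (suc x')) → Bumps A y (just z) → z ≤ x' →
                     suc (suc (B z)) ≤ B (suc x')
  gap-before-tight {x'} {suc z'} (_ , refl , _ , tight , slack) (s≤s y≤z' , flat , jump) z≤x' = begin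
    suc (suc (B (suc z'))) ≤⟨ s≤s (slack z' (≤-trans 1≤y y≤z') z≤x') ⟩
    suc (A z')             ≡⟨ cong suc (flat z' y≤z' ≤-refl) ⟩
    suc (A y)              ≤⟨ jump ⟩
    A (suc z')             ≤⟨ count-mono a z≤x' ⟩
    A x'                   ≡⟨ sym tight ⟩
    B (suc x')             ∎
    where open ≤-Reasoning

  -- Between z and X the second row of S exceeds b by one, and from X on they agree;
  -- the gap of two below X makes both rows bump the same letter.
  row₁-bump-before-tight : ∀ {X z m} → 2 ≤ z → z < X → suc (suc (B z)) ≤ B X → Row₁Rel s₁ b (just X) → Bumps B z m →
                           Σ ℕ λ u → m ≡ just u × u ≤ X × Bumps (count s₁) z (just u)
  row₁-bump-before-tight {X} {z} {nothing} 2≤z z<X gap rel₁ flat = ⊥-elim (2+m≤n⇒n≢m gap (flat X (<⇒≤ z<X)))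
  row₁-bump-before-tight {X} {z} {just u} 2≤z z<X gap rel₁ (z<u , flat , jump) with X <? u
  ... | yes X<u = ⊥-elim (2+m≤n⇒n≢m gap (flat X (<⇒≤ z<X) X<u))
  ... | no X≮u = u , refl , u≤X , z<u , flat₁ , jump₁
    where
      u≤X = ≮⇒≥ X≮u
      s₁≡ : ∀ t → z ≤ t → t < X → count s₁ t ≡ B t + 1
      s₁≡ t z≤t t<X = m+0≡n+1⇒m≡n+1 (subst-summands (count s₁ t) (B t) (rel₁ t) (step-off t<X) (step-on (≤-trans 2≤z z≤t)))
      flat₁ : ∀ t → z ≤ t → t < u → count s₁ t ≡ count s₁ z
      flat₁ t z≤t t<u = trans (s₁≡ t z≤t (<-≤-trans t<u u≤X)) (trans (cong (_+ 1) (flat t z≤t t<u)) (sym (s₁≡ z ≤-refl z<X)))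
      jump₁ : count s₁ z < count s₁ u
      jump₁ with u <? X
      ... | yes u<X = subst₂ _<_ (sym (s₁≡ z ≤-refl z<X)) (sym (s₁≡ u (<⇒≤ z<u) u<X)) (+-monoˡ-< 1 jump)
      ... | no u≮X with ≤-antisym u≤X (≮⇒≥ u≮X)
      ...   | refl = subst₂ _<_ (sym (s₁≡ z ≤-refl z<X)) (sym s₁≡B) (subst (_≤ B X) (cong suc (+-comm 1 (B z))) gap)
        where
          s₁≡B : count s₁ X ≡ B X
          s₁≡B = m+1≡n+1⇒m≡n (subst-summands (count s₁ X) (B X) (rel₁ X) (step-on ≤-refl) (step-on (≤-trans 2≤z (<⇒≤ z<X))))

  tight≤y : ∀ {x' mz mz₁ a' b' m s₀' s₁' m₁} → FirstTight a b (just (suc x')) → suc x' ≤ y →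
    Row₀Rel s₀ a (just (suc x')) → Row₁Rel s₁ b (just (suc x')) →
    Insertion₂ y a b mz a' b' m → Insertion₂ y s₀ s₁ mz₁ s₀' s₁' m₁ → Result s₀' s₁' m₁ a' b' m
  tight≤y {x'} {mz} {mz₁} {a'} {b'} {m} {m₁ = m₁} ft X≤y rel₀ rel₁ (ins₂ bA eA rB) (ins₂ bS eS rS)
    with Bumps-unique (count s₀) y mz₁ mz bS (Bumps-shift (count s₀) A y 2 mz shift bA)
    where
      shift : ∀ t → y ≤ t → count s₀ t ≡ 2 + A t
      shift t y≤t = trans (rel₀ t) (trans (cong₂ (λ p q → p + (A t + q)) (step-on (≤-trans 1≤y y≤t)) (step-on (≤-trans X≤y y≤t))) (cong suc (+-comm (A t) 1)))
  tight≤y {x'} {nothing} {a' = a'} ft X≤y rel₀ rel₁ (ins₂ bA eA (refl , refl)) (ins₂ bS eS (refl , refl)) | refl =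
    (_ , FirstTight-transport same₀ (λ _ _ → refl) ft , Row₀Rel-same (just (suc x')) nothing rel₀ eS eA , rel₁) , refl
    where
      same₀ : ∀ t → t ≤ x' → count a' t ≡ A t
      same₀ t t≤x' = m+0≡n+0⇒m≡n (subst-summands (count a' t) (A t) (eA t) refl (step-off (<-≤-trans (s≤s t≤x') X≤y)))
  tight≤y {x'} {just z} {a' = a'} {b'} {m} {m₁ = m₁} ft X≤y rel₀ rel₁ (ins₂ bA eA (bB , eB)) (ins₂ bS eS (bS₁ , eS₁)) | refl
    with Bumps-unique (count s₁) z m₁ m bS₁ (Bumps-shift (count s₁) B z 0 m shift₁ bB)
    where
      shift₁ : ∀ t → z ≤ t → count s₁ t ≡ 0 + B t
      shift₁ t z≤t = m+1≡n+1⇒m≡n (subst-summands (count s₁ t) (B t) (rel₁ t)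
        (step-on (≤-trans X≤y (≤-trans (<⇒≤ (proj₁ bA)) z≤t))) (step-on (≤-trans (s≤s 1≤y) (≤-trans (proj₁ bA) z≤t))))
  ... | refl = (_ , FirstTight-transport same₀ same₁ ft , Row₀Rel-same (just (suc x')) (just z) rel₀ eS eA , Row₁Rel-same (just (suc x')) m rel₁ eS₁ eB) , refl
    where
      same₀ : ∀ t → t ≤ x' → count a' t ≡ A t
      same₀ t t≤x' = m+0≡n+0⇒m≡n (subst-summands (count a' t) (A t) (eA t) (step-off (<-trans t<y (proj₁ bA))) (step-off t<y))
        where t<y = <-≤-trans (s≤s t≤x') X≤y
      same₁ : ∀ t → t ≤ x' → count b' (suc t) ≡ B (suc t)
      same₁ t t≤x' = m+0≡n+0⇒m≡n (subst-summands (count b' (suc t)) (B (suc t)) (eB (suc t)) (Bumps⇒stepᵐ-below B z m bB (suc t) (<⇒≤ t<z)) (step-off t<z))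
        where t<z = ≤-<-trans (≤-trans (s≤s t≤x') X≤y) (proj₁ bA)

  slack-noBump : ∀ {mz₁ a' b' m s₀' s₁' m₁} → FirstTight a b nothing → Row₀Rel s₀ a nothing → Row₁Rel s₁ b nothing →
    Insertion₂ y a b nothing a' b' m → Insertion₂ y s₀ s₁ mz₁ s₀' s₁' m₁ → Result s₀' s₁' m₁ a' b' m
  slack-noBump {mz₁} slack rel₀ rel₁ (ins₂ bA eA rB) (ins₂ bS eS rS)
    with Bumps-unique (count s₀) y mz₁ nothing bS (Bumps-shift (count s₀) A y 1 nothing shift bA)
    where
      shift : ∀ t → y ≤ t → count s₀ t ≡ 1 + A t
      shift t y≤t = trans (rel₀ t) (cong₂ _+_ (step-on (≤-trans 1≤y y≤t)) (+-identityʳ (A t)))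
  slack-noBump slack rel₀ rel₁ (ins₂ bA eA (refl , refl)) (ins₂ bS eS (refl , refl)) | refl =
    (nothing , (λ t 1≤t → <-≤-trans (slack t 1≤t) (count-grows nothing t (eA t) refl)) , Row₀Rel-same nothing nothing rel₀ eS eA , rel₁) , refl

  y<tight-noBump : ∀ {x' mz₁ a' b' m s₀' s₁' m₁} → FirstTight a b (just (suc x')) → y ≤ x' →
    Row₀Rel s₀ a (just (suc x')) → Row₁Rel s₁ b (just (suc x')) →
    Insertion₂ y a b nothing a' b' m → Insertion₂ y s₀ s₁ mz₁ s₀' s₁' m₁ → Result s₀' s₁' m₁ a' b' m
  y<tight-noBump {x'} {mz₁} {m₁ = m₁} (_ , refl , 1≤x' , tight , slack) y≤x' rel₀ rel₁ (ins₂ bA eA (refl , refl)) (ins₂ bS eS rS)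
    with Bumps-unique (count s₀) y mz₁ (just (suc x')) bS
           (S-bumps (just (suc x')) (s≤s y≤x') (λ t y≤t _ → bA t y≤t) (λ t t<X → step-off t<X) (below-tight-jump (≤-trans y≤x' (n≤1+n x'))) rel₀)
  ... | refl with Bumps-unique (count s₁) (suc x') m₁ nothing (proj₁ rS) flat₁
    where
      s₁≡B : ∀ t → suc x' ≤ t → count s₁ t ≡ B t
      s₁≡B t X≤t = m+1≡n+1⇒m≡n (subst-summands (count s₁ t) (B t) (rel₁ t) (step-on X≤t) (step-on (≤-trans (s≤s 1≤x') X≤t)))
      flat₁ : ∀ t → suc x' ≤ t → count s₁ t ≡ count s₁ (suc x')
      flat₁ t X≤t = trans (s₁≡B t X≤t)
        (trans (B-flat-after-tight tight (λ u x'≤u _ → trans (bA u (≤-trans y≤x' x'≤u)) (sym (bA x' y≤x'))) t X≤t ≤-refl)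
               (sym (s₁≡B (suc x') ≤-refl)))
  ... | refl = (nothing , (λ t 1≤t → slack-gained slack y≤x' t 1≤t (eA t)) , Row₀Rel-swap (just (suc x')) nothing rel₀ eS eA , (λ t → trans (proj₂ rS t) (rel₁ t))) , refl

  slack-bump : ∀ {z mz₁ a' b' m s₀' s₁' m₁} → FirstTight a b nothing → Row₀Rel s₀ a nothing → Row₁Rel s₁ b nothing →
    Insertion₂ y a b (just z) a' b' m → Insertion₂ y s₀ s₁ mz₁ s₀' s₁' m₁ → Result s₀' s₁' m₁ a' b' m
  slack-bump {z} {mz₁} {m = m} {m₁ = m₁} slack rel₀ rel₁ (ins₂ bA eA (bB , eB)) (ins₂ bS eS rS)
    with Bumps-unique (count s₀) y mz₁ (just z) bS (S-bumps nothing (proj₁ bA) (proj₁ (proj₂ bA)) (λ _ _ → refl) (<-≤-trans (proj₂ (proj₂ bA)) (m≤m+n _ _)) rel₀)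
  ... | refl with Bumps-unique (count s₁) z m₁ m (proj₁ rS) (Bumps-shift (count s₁) B z 1 m shift₁ bB)
    where
      shift₁ : ∀ t → z ≤ t → count s₁ t ≡ 1 + B t
      shift₁ t z≤t = trans (m+0≡n+1⇒m≡n+1 (subst-summands (count s₁ t) (B t) (rel₁ t) refl (step-on (≤-trans (s≤s 1≤y) (≤-trans (proj₁ bA) z≤t))))) (+-comm (B t) 1)
  ... | refl = (nothing , (λ t 1≤t → slack-after-bump bA eA bB eB t 1≤t (λ s 1≤s _ → slack s 1≤s)) , Row₀Rel-same nothing (just z) rel₀ eS eA , Row₁Rel-same nothing m rel₁ (proj₂ rS) eB) , refl

  bump≡tight : ∀ {x' mz₁ a' b' m s₀' s₁' m₁} → FirstTight a b (just (suc x')) →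
    Row₀Rel s₀ a (just (suc x')) → Row₁Rel s₁ b (just (suc x')) →
    Insertion₂ y a b (just (suc x')) a' b' m → Insertion₂ y s₀ s₁ mz₁ s₀' s₁' m₁ → Result s₀' s₁' m₁ a' b' m
  bump≡tight {x'} {mz₁} {a'} {b'} {m} {m₁ = m₁} (_ , refl , 1≤x' , tight , slack) rel₀ rel₁ (ins₂ bA eA (bB , eB)) (ins₂ bS eS rS)
    with Bumps-unique (count s₀) y mz₁ (just (suc x')) bS (S-bumps (just (suc x')) (proj₁ bA) (proj₁ (proj₂ bA)) (λ t t<X → step-off t<X) (<-≤-trans (proj₂ (proj₂ bA)) (m≤m+n _ _)) rel₀)
  ... | refl with Bumps-unique (count s₁) (suc x') m₁ m (proj₁ rS) (Bumps-shift (count s₁) B (suc x') 0 m shift₁ bB)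
    where
      shift₁ : ∀ t → suc x' ≤ t → count s₁ t ≡ 0 + B t
      shift₁ t X≤t = m+1≡n+1⇒m≡n (subst-summands (count s₁ t) (B t) (rel₁ t) (step-on X≤t) (step-on (≤-trans (s≤s 1≤x') X≤t)))
  ... | refl = (just (suc x') , (x' , refl , 1≤x' , tight' , slack') , Row₀Rel-same (just (suc x')) (just (suc x')) rel₀ eS eA , Row₁Rel-same (just (suc x')) m rel₁ (proj₂ rS) eB) , refl
    where
      a'≡ : count a' x' ≡ A x' + 1
      a'≡ = m+0≡n+1⇒m≡n+1 (subst-summands (count a' x') (A x') (eA x') (step-off (n<1+n x')) (step-on (≤-pred (proj₁ bA))))
      b'≡ : count b' (suc x') ≡ B (suc x') + 1
      b'≡ = m+0≡n+1⇒m≡n+1 (subst-summands (count b' (suc x')) (B (suc x')) (eB (suc x')) (Bumps⇒stepᵐ-below B (suc x') m bB (suc x') ≤-refl) (step-on ≤-refl))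
      tight' : count b' (suc x') ≡ count a' x'
      tight' = trans b'≡ (trans (cong (_+ 1) tight) (sym a'≡))
      slack' : ∀ t → 1 ≤ t → t < x' → Slack a' b' t
      slack' t 1≤t t<x' = slack-after-bump bA eA bB eB t 1≤t (λ s 1≤s s≤t → slack s 1≤s (≤-<-trans s≤t t<x'))

  bump<tight : ∀ {x' z mz₁ a' b' m s₀' s₁' m₁} → FirstTight a b (just (suc x')) → z ≤ x' →
    Row₀Rel s₀ a (just (suc x')) → Row₁Rel s₁ b (just (suc x')) →
    Insertion₂ y a b (just z) a' b' m → Insertion₂ y s₀ s₁ mz₁ s₀' s₁' m₁ → Result s₀' s₁' m₁ a' b' m
  bump<tight {x'} {z} {mz₁} {a'} {b'} {m} {m₁ = m₁} ft@(_ , refl , 1≤x' , tight , slack) z≤x' rel₀ rel₁ (ins₂ bA eA (bB , eB)) (ins₂ bS eS rS)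
    with Bumps-unique (count s₀) y mz₁ (just z) bS
           (S-bumps (just (suc x')) (proj₁ bA) (proj₁ (proj₂ bA)) (λ t t<z → step-off (<-≤-trans t<z (≤-trans z≤x' (n≤1+n x')))) (<-≤-trans (proj₂ (proj₂ bA)) (m≤m+n _ _)) rel₀)
  ... | refl with row₁-bump-before-tight (≤-trans (s≤s 1≤y) (proj₁ bA)) (s≤s z≤x') (gap-before-tight ft bA z≤x') rel₁ bB
  ... | u , refl , u≤X , bS₁ with Bumps-unique (count s₁) z m₁ (just u) (proj₁ rS) bS₁
  ... | refl = (just (suc x') , (x' , refl , 1≤x' , tight' , slack') , Row₀Rel-same (just (suc x')) (just z) rel₀ eS eA , Row₁Rel-same (just (suc x')) (just u) rel₁ (proj₂ rS) eB) , refl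
    where
      a'≡ : count a' x' ≡ A x'
      a'≡ = m+1≡n+1⇒m≡n (subst-summands (count a' x') (A x') (eA x') (step-on z≤x') (step-on (≤-trans (<⇒≤ (proj₁ bA)) z≤x')))
      b'≡ : count b' (suc x') ≡ B (suc x')
      b'≡ = m+1≡n+1⇒m≡n (subst-summands (count b' (suc x')) (B (suc x')) (eB (suc x')) (step-on u≤X) (step-on (≤-trans z≤x' (n≤1+n x'))))
      tight' : count b' (suc x') ≡ count a' x'
      tight' = trans b'≡ (trans tight (sym a'≡))
      slack' : ∀ t → 1 ≤ t → t < x' → Slack a' b' t
      slack' t 1≤t t<x' = slack-after-bump bA eA bB eB t 1≤t (λ s 1≤s s≤t → slack s 1≤s (≤-<-trans s≤t t<x'))

  tight<bump : ∀ {x' z mz₁ a' b' m s₀' s₁' m₁} → FirstTight a b (just (suc x')) → y ≤ x' → suc x' < z →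
    Row₀Rel s₀ a (just (suc x')) → Row₁Rel s₁ b (just (suc x')) →
    Insertion₂ y a b (just z) a' b' m → Insertion₂ y s₀ s₁ mz₁ s₀' s₁' m₁ → Result s₀' s₁' m₁ a' b' m
  tight<bump {x'} {suc z'} {mz₁} {a'} {b'} {m} {s₀'} {s₁'} {m₁} ft@(_ , refl , 1≤x' , tight , slack) y≤x' X<z rel₀ rel₁
             (ins₂ bA@(s≤s y≤z' , flat , jump) eA (bB , eB)) (ins₂ bS eS rS)
    with Bumps-unique (count s₀) y mz₁ (just (suc x')) bS
           (S-bumps (just (suc x')) (s≤s y≤x') (λ t y≤t t<X → flat t y≤t (<-trans t<X X<z)) (λ t t<X → step-off t<X) (below-tight-jump (≤-trans y≤x' (n≤1+n x'))) rel₀)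
  ... | refl with Bumps-unique (count s₁) (suc x') m₁ m (proj₁ rS) (Bumps-shift (count s₁) B (suc x') 0 m shift₁ (Bumps-extend B m (<⇒≤ X<z) (B-flat-until-bump ft y≤x' bA X<z) bB))
    where
      shift₁ : ∀ t → suc x' ≤ t → count s₁ t ≡ 0 + B t
      shift₁ t X≤t = m+1≡n+1⇒m≡n (subst-summands (count s₁ t) (B t) (rel₁ t) (step-on X≤t) (step-on (≤-trans (s≤s 1≤x') X≤t)))
  ... | refl = (just (suc z') , (z' , refl , ≤-trans 1≤y y≤z' , tight' , slack') , Row₀Rel-swap (just (suc x')) (just (suc z')) rel₀ eS eA , Row₁Rel-swap (just (suc x')) (just (suc z')) m rel₁ (proj₂ rS) eB) , refl
    where
      open ≡-Reasoning
      a'≡ : count a' z' ≡ A z' + 1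
      a'≡ = m+0≡n+1⇒m≡n+1 (subst-summands (count a' z') (A z') (eA z') (step-off (n<1+n z')) (step-on y≤z'))
      b'≡ : count b' (suc z') ≡ B (suc z') + 1
      b'≡ = m+0≡n+1⇒m≡n+1 (subst-summands (count b' (suc z')) (B (suc z')) (eB (suc z')) (Bumps⇒stepᵐ-below B (suc z') m bB (suc z') ≤-refl) (step-on ≤-refl))
      tight' : count b' (suc z') ≡ count a' z'
      tight' = begin
        count b' (suc z') ≡⟨ b'≡ ⟩
        B (suc z') + 1    ≡⟨ cong (_+ 1) (B-flat-until-bump ft y≤x' bA X<z (suc z') (<⇒≤ X<z) ≤-refl) ⟩
        B (suc x') + 1    ≡⟨ cong (_+ 1) (trans tight (trans (flat x' y≤x' (<-trans (n<1+n x') X<z)) (sym (flat z' y≤z' ≤-refl)))) ⟩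
        A z' + 1          ≡⟨ sym a'≡ ⟩
        count a' z'       ∎
      slack' : ∀ t → 1 ≤ t → t < z' → Slack a' b' t
      slack' t 1≤t t<z' = ≤-<-trans (count-shrinks m (suc t) (eB (suc t)) (step-off (s≤s t<z')))
        (slack-gained slack y≤x' t 1≤t (subst-summands (count a' t) (A t) (eA t) (step-off (<-trans t<z' (n<1+n z'))) refl))

  related : ∀ {x mz mz₁ a' b' m s₀' s₁' m₁} → FirstTight a b x → Row₀Rel s₀ a x → Row₁Rel s₁ b x →
    Insertion₂ y a b mz a' b' m → Insertion₂ y s₀ s₁ mz₁ s₀' s₁' m₁ → Result s₀' s₁' m₁ a' b' m
  related {nothing} {nothing} = slack-noBump
  related {nothing} {just _} = slack-bump
  related {just zero} (_ , () , _)
  related {just (suc x')} {mz} ft rel₀ rel₁ insT insS with suc x' ≤? y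
  related {just (suc x')} {mz} ft rel₀ rel₁ insT insS | yes X≤y = tight≤y ft X≤y rel₀ rel₁ insT insS
  related {just (suc x')} {nothing} ft rel₀ rel₁ insT insS | no X≰y = y<tight-noBump ft (≤-pred (≰⇒> X≰y)) rel₀ rel₁ insT insS
  related {just (suc x')} {just z} ft rel₀ rel₁ insT insS | no X≰y with <-cmp z (suc x')
  ... | tri< z<X _ _ = bump<tight ft (≤-pred z<X) rel₀ rel₁ insT insS
  ... | tri≈ _ refl _ = bump≡tight ft rel₀ rel₁ insT insS
  ... | tri> _ _ X<z = tight<bump ft (≤-pred (≰⇒> X≰y)) X<z rel₀ rel₁ insT insS

Related₃ : List ℕ × List ℕ × Tableau → List ℕ × List ℕ × Tableau → Set
Related₃ (s₀ , s₁ , R) (a , b , R') = Rel12 s₀ s₁ a b × R ≡ R'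

Related : Tableau → Tableau → Set
Related S T = Related₃ (split₂ S) (split₂ T)

split₂-insert≡ : ∀ y T {a' b' m} → insertRow₂ y (row₀ T) (row₁ T) ≡ (a' , b' , m) → split₂ (insert y T) ≡ (a' , b' , insertᵐ m (rows₂ T))
split₂-insert≡ y T eq = trans (split₂-insert y T) (cong (λ p → stack₂ p (rows₂ T)) eq)

Related-insert : ∀ y → 1 ≤ y → ∀ S T → Semistandard S → Semistandard T → Related S T → Related (insert y S) (insert y T)
Related-insert y 1≤y S T ssS ssT ((x , ft , rel₀ , rel₁) , rows≡)
  with insertRow₂ y (row₀ S) (row₁ S) in eqS | insertRow₂-spec y (row₀ S) (row₁ S) (sorted₀ S ssS) (sorted₁ S ssS)
     | insertRow₂ y (row₀ T) (row₁ T) in eqT | insertRow₂-spec y (row₀ T) (row₁ T) (sorted₀ T ssT) (sorted₁ T ssT)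
... | (s₀' , s₁' , m₁) | (_ , _ , _ , insS) | (a' , b' , m) | (_ , _ , _ , insT)
  with Insertion12.related y 1≤y (strict₀₁ T ssT) ft rel₀ rel₁ insT insS
... | rel' , refl = subst₂ Related₃ (sym (split₂-insert≡ y S eqS)) (sym (split₂-insert≡ y T eqT)) (rel' , cong (insertᵐ m) rows≡)

Invariant : Tableau → Tableau → Set
Invariant S T = Semistandard S × Semistandard T × Positive T × NonEmptyRows S × NonEmptyRows T × Related S T

Invariant-insert : ∀ y → 1 ≤ y → ∀ S T → Invariant S T → Invariant (insert y S) (insert y T)
Invariant-insert y 1≤y S T (ssS , ssT , pos , neS , neT , rel) =
  Semistandard-insert y S ssS , Semistandard-insert y T ssT , Positive-insert y T 1≤y ssT pos
  , NonEmptyRows-insert y S neS , NonEmptyRows-insert y T neT , Related-insert y 1≤y S T ssS ssT rel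

Invariant-foldl : ∀ w S T → All (1 ≤_) w → Invariant S T →
                  Invariant (foldl (λ U x → insert x U) S w) (foldl (λ U x → insert x U) T w)
Invariant-foldl [] S T _ inv = inv
Invariant-foldl (y ∷ w) S T (1≤y ∷ 1≤w) inv = Invariant-foldl w (insert y S) (insert y T) 1≤w (Invariant-insert y 1≤y S T inv)

-- Before any letter of w, P(12) = [[1, 2]] and P() = [] are related with x = 2.
Invariant-P : ∀ w → All (1 ≤_) w → Invariant (P (1 ∷ 2 ∷ w)) (P w)
Invariant-P w 1≤w = Invariant-foldl w ((1 ∷ 2 ∷ []) ∷ []) [] 1≤w base
  where
    base : Invariant ((1 ∷ 2 ∷ []) ∷ []) []
    base = ((s≤s z≤n ∷ []) ∷ [] ∷ [] , (λ v → ≤-trans (≤-reflexive (count-[] (suc v))) z≤n) , tt) , tt , count-[] 0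
         , (s≤s z≤n ∷ []) , []
         , (just 2 , (1 , refl , ≤-refl , trans (count-[] 2) (sym (count-[] 1)) , λ t 1≤t t<1 → ⊥-elim (<⇒≱ t<1 1≤t))
           , row₀≡ , (λ t → refl)) , refl
      where
        row₀≡ : Row₀Rel (1 ∷ 2 ∷ []) [] (just 2)
        row₀≡ t = begin
          count (1 ∷ 2 ∷ []) t             ≡⟨ count-∷ 1 _ t ⟩
          step 1 t + count (2 ∷ []) t      ≡⟨ cong (step 1 t +_) (trans (count-∷ 2 [] t) (cong (step 2 t +_) (count-[] t))) ⟩
          step 1 t + (step 2 t + 0)        ≡⟨ cong (step 1 t +_) (+-comm (step 2 t) 0) ⟩
          step 1 t + (0 + step 2 t)        ≡⟨ cong (λ k → step 1 t + (k + step 2 t)) (sym (count-[] t)) ⟩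
          step 1 t + (count [] t + step 2 t) ∎
          where open ≡-Reasoning

-- Inserting 1 and then 2 into P(w)

split₂-insert² : ∀ y₁ y₂ T {a₁ b₁ m₁ a₂ b₂ m₂} → insertRow₂ y₁ (row₀ T) (row₁ T) ≡ (a₁ , b₁ , m₁) →
  insertRow₂ y₂ a₁ b₁ ≡ (a₂ , b₂ , m₂) → split₂ (insert y₂ (insert y₁ T)) ≡ (a₂ , b₂ , insertᵐ m₂ (insertᵐ m₁ (rows₂ T)))
split₂-insert² y₁ y₂ T {a₁} {b₁} {m₁} eq₁ eq₂ = begin
  split₂ (insert y₂ (insert y₁ T))
    ≡⟨ split₂-insert y₂ (insert y₁ T) ⟩
  stack₂ (insertRow₂ y₂ (row₀ (insert y₁ T)) (row₁ (insert y₁ T))) (rows₂ (insert y₁ T))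
    ≡⟨ cong (λ p → stack₂ (insertRow₂ y₂ (proj₁ p) (proj₁ (proj₂ p))) (proj₂ (proj₂ p))) (split₂-insert≡ y₁ T eq₁) ⟩
  stack₂ (insertRow₂ y₂ a₁ b₁) (insertᵐ m₁ (rows₂ T))
    ≡⟨ cong (λ p → stack₂ p (insertᵐ m₁ (rows₂ T))) eq₂ ⟩
  _ ∎
  where open ≡-Reasoning

ones-twos : ℕ → ℕ → List ℕ
ones-twos α β = replicate α 1 ++ replicate β 2

count-ones-twos : ∀ α β t → count (ones-twos α β) t ≡ α * step 1 t + β * step 2 t
count-ones-twos α β t = trans (count-++ (replicate α 1) (replicate β 2) t) (cong₂ _+_ (count-replicate α 1 t) (count-replicate β 2 t))

sorted-replicate : ∀ n v → Sorted (replicate n v)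
sorted-replicate zero v = []
sorted-replicate (suc n) v = replicate⁺ n ≤-refl ∷ sorted-replicate n v

sorted-ones-twos : ∀ α β → Sorted (ones-twos α β)
sorted-ones-twos zero β = sorted-replicate β 2
sorted-ones-twos (suc α) β = ++⁺ (replicate⁺ α ≤-refl) (replicate⁺ β (s≤s z≤n)) ∷ sorted-ones-twos α β

Shape12 : List ℕ → List ℕ → Set
Shape12 a b = Σ ℕ λ α → Σ ℕ λ β → Σ ℕ λ γ →
  a ≡ ones-twos α β × b ≡ replicate γ 2 × (γ ≡ α × β ≡ 0 ⊎ γ < α × 1 ≤ β)

Shape12-from-counts : ∀ {a b} α β γ → Sorted a → Sorted b → (∀ t → count a t ≡ α * step 1 t + β * step 2 t) →
  (∀ t → count b t ≡ γ * step 2 t) → (γ ≡ α × β ≡ 0 ⊎ γ < α × 1 ≤ β) → Shape12 a b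
Shape12-from-counts α β γ sorted-a sorted-b count-a count-b shape =
  α , β , γ , count-injective sorted-a (sorted-ones-twos α β) (λ t → trans (count-a t) (sym (count-ones-twos α β t)))
  , count-injective sorted-b (sorted-ones-twos 0 γ) (λ t → trans (count-b t) (sym (count-ones-twos 0 γ t))) , shape

weighted-steps : ∀ p q {t i j} → step 1 t ≡ i → step 2 t ≡ j → p * step 1 t + q * step 2 t ≡ p * i + q * j
weighted-steps p q refl refl = refl

two-step-form : ∀ (f : ℕ → ℕ) → f 0 ≡ 0 → f 1 ≤ f 2 → (∀ t → 2 ≤ t → f t ≡ f 2) →
                ∀ t → f t ≡ f 1 * step 1 t + (f 2 ∸ f 1) * step 2 t
two-step-form f f0 f1≤f2 flat zero = begin
  f 0                                                 ≡⟨ f0 ⟩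
  0                                                   ≡⟨ sym (cong₂ _+_ (*-zeroʳ (f 1)) (*-zeroʳ (f 2 ∸ f 1))) ⟩
  f 1 * 0 + (f 2 ∸ f 1) * 0                           ≡⟨ sym (weighted-steps (f 1) (f 2 ∸ f 1) (step-off z<s) (step-off z<s)) ⟩
  f 1 * step 1 0 + (f 2 ∸ f 1) * step 2 0             ∎
  where open ≡-Reasoning
two-step-form f f0 f1≤f2 flat (suc zero) = begin
  f 1                                                 ≡⟨ sym (trans (cong₂ _+_ (*-identityʳ (f 1)) (*-zeroʳ (f 2 ∸ f 1))) (+-identityʳ (f 1))) ⟩
  f 1 * 1 + (f 2 ∸ f 1) * 0                           ≡⟨ sym (weighted-steps (f 1) (f 2 ∸ f 1) (step-on ≤-refl) (step-off (n<1+n 1))) ⟩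
  f 1 * step 1 1 + (f 2 ∸ f 1) * step 2 1             ∎
  where open ≡-Reasoning
two-step-form f f0 f1≤f2 flat t@(suc (suc _)) = begin
  f t                                                 ≡⟨ flat t (s≤s (s≤s z≤n)) ⟩
  f 2                                                 ≡⟨ sym (m+[n∸m]≡n f1≤f2) ⟩
  f 1 + (f 2 ∸ f 1)                                   ≡⟨ sym (cong₂ _+_ (*-identityʳ (f 1)) (*-identityʳ (f 2 ∸ f 1))) ⟩
  f 1 * 1 + (f 2 ∸ f 1) * 1                           ≡⟨ sym (weighted-steps (f 1) (f 2 ∸ f 1) (step-on (s≤s z≤n)) (step-on (s≤s (s≤s z≤n)))) ⟩
  f 1 * step 1 t + (f 2 ∸ f 1) * step 2 t             ∎
  where open ≡-Reasoning

one-step-form : ∀ (f : ℕ → ℕ) → f 0 ≡ 0 → f 1 ≡ 0 → (∀ t → 2 ≤ t → f t ≡ f 2) → ∀ t → f t ≡ f 2 * step 2 t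
one-step-form f f0 f1 flat t =
  subst (λ k → f t ≡ k * step 1 t + (f 2 ∸ k) * step 2 t) f1 (two-step-form f f0 (subst (_≤ f 2) (sym f1) z≤n) flat t)

stepᵐ≡step⇒≡just : ∀ p c → (∀ t → stepᵐ p t ≡ step c t) → p ≡ just c
stepᵐ≡step⇒≡just nothing c eq = ⊥-elim (0≢1+n (trans (eq c) (step-on ≤-refl)))
stepᵐ≡step⇒≡just (just d) c eq with <-cmp d c
... | tri< d<c _ _ = ⊥-elim (1+n≢0 (trans (sym (step-on ≤-refl)) (trans (eq d) (step-off d<c))))
... | tri≈ _ refl _ = refl
... | tri> _ _ c<d = ⊥-elim (0≢1+n (trans (sym (step-off c<d)) (trans (eq c) (step-on ≤-refl))))

2≰1 : ¬ 2 ≤ 1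
2≰1 (s≤s ())

-- Both steps are up at t = d + e.
two-steps≰step : ∀ d e c (k : ℕ → ℕ) → ¬ (∀ t → step d t + (step e t + k t) ≡ step c t)
two-steps≰step d e c k eq = 2≰1 (begin
  2                                       ≡⟨ cong₂ (λ p q → p + (q + 0)) (sym (step-on (m≤m+n d e))) (sym (step-on (m≤n+m e d))) ⟩
  step d (d + e) + (step e (d + e) + 0)   ≤⟨ +-monoʳ-≤ (step d (d + e)) (+-monoʳ-≤ (step e (d + e)) z≤n) ⟩
  step d (d + e) + (step e (d + e) + k (d + e)) ≡⟨ eq (d + e) ⟩
  step c (d + e)                          ≤⟨ step≤1 c (d + e) ⟩
  1                                       ∎)
  where open ≤-Reasoning

single-step : ∀ p q r c → (∀ t → stepᵐ p t + (stepᵐ q t + stepᵐ r t) ≡ step c t) →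
  p ≡ just c × q ≡ nothing × r ≡ nothing ⊎ p ≡ nothing × q ≡ just c × r ≡ nothing ⊎ p ≡ nothing × q ≡ nothing × r ≡ just c
single-step nothing nothing nothing c eq = ⊥-elim (0≢1+n (trans (eq c) (step-on ≤-refl)))
single-step (just d) nothing nothing c eq = inj₁ (stepᵐ≡step⇒≡just (just d) c (λ t → trans (sym (+-identityʳ _)) (eq t)) , refl , refl)
single-step nothing (just d) nothing c eq = inj₂ (inj₁ (refl , stepᵐ≡step⇒≡just (just d) c (λ t → trans (sym (+-identityʳ _)) (eq t)) , refl))
single-step nothing nothing (just d) c eq = inj₂ (inj₂ (refl , refl , stepᵐ≡step⇒≡just (just d) c eq))
single-step (just d) (just e) r c eq = ⊥-elim (two-steps≰step d e c (stepᵐ r) eq)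
single-step (just d) nothing (just e) c eq = ⊥-elim (two-steps≰step d e c (λ _ → 0) λ t → trans (cong (step d t +_) (+-comm (step e t) 0)) (eq t))
single-step nothing (just d) (just e) c eq = ⊥-elim (two-steps≰step d e c (λ _ → 0) λ t → trans (cong (step d t +_) (+-identityʳ (step e t))) (eq t))

ColumnStrict⇒count≤1≡0 : ∀ {a b} → count a 0 ≡ 0 → ColumnStrict a b → ∀ t → t ≤ 1 → count b t ≡ 0
ColumnStrict⇒count≤1≡0 {a} {b} pos a≺b t t≤1 = n≤0⇒n≡0 (≤-trans (count-mono b t≤1) (≤-trans (a≺b 0) (≤-reflexive pos)))

Shape12-tight-at-2 : ∀ {a b} → Sorted a → Sorted b → count a 0 ≡ 0 → ColumnStrict a b →
  FirstTight a b (just 2) → Bumps (count a) 1 nothing → Shape12 a b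
Shape12-tight-at-2 {a} {b} sorted-a sorted-b pos a≺b (_ , refl , _ , tight , _) flat =
  Shape12-from-counts α 0 α sorted-a sorted-b count-a count-b (inj₁ (refl , refl))
  where
    α = count a 1
    flat₂ : ∀ t → 2 ≤ t → count a t ≡ count a 2
    flat₂ t 2≤t = trans (flat t (≤-trans (n≤1+n 1) 2≤t)) (sym (flat 2 (n≤1+n 1)))
    count-a : ∀ t → count a t ≡ α * step 1 t + 0 * step 2 t
    count-a t = trans (two-step-form (count a) pos (≤-reflexive (sym (flat 2 (n≤1+n 1)))) flat₂ t)
                      (cong (λ k → α * step 1 t + k * step 2 t) (trans (cong (_∸ α) (flat 2 (n≤1+n 1))) (n∸n≡0 α)))
    flat-b : ∀ t → 2 ≤ t → count b t ≡ count b 2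
    flat-b (suc t) (s≤s 1≤t) = ≤-antisym (≤-trans (a≺b t) (≤-reflexive (trans (flat t 1≤t) (sym tight)))) (count-mono b (s≤s 1≤t))
    count-b : ∀ t → count b t ≡ α * step 2 t
    count-b t = trans (one-step-form (count b) (ColumnStrict⇒count≤1≡0 pos a≺b 0 z≤n) (ColumnStrict⇒count≤1≡0 pos a≺b 1 ≤-refl) flat-b t)
                      (cong (_* step 2 t) tight)

Shape12-bump-at-2 : ∀ {a b a₁} → Sorted a → Sorted b → count a 0 ≡ 0 → ColumnStrict a b →
  FirstTight a b nothing → Bumps (count a) 1 (just 2) → Bumps (count b) 2 nothing →
  (∀ t → count a₁ t + step 2 t ≡ count a t + step 1 t) → Bumps (count a₁) 2 nothing → Shape12 a b
Shape12-bump-at-2 {a} {b} {a₁} sorted-a sorted-b pos a≺b slack (_ , _ , jump) flat-b a₁≡ flat-a₁ =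
  Shape12-from-counts (count a 1) (count a 2 ∸ count a 1) (count b 2) sorted-a sorted-b
    (two-step-form (count a) pos (<⇒≤ jump) flat-a)
    (one-step-form (count b) (ColumnStrict⇒count≤1≡0 pos a≺b 0 z≤n) (ColumnStrict⇒count≤1≡0 pos a≺b 1 ≤-refl) flat-b)
    (inj₂ (slack 1 ≤-refl , m<n⇒0<n∸m jump))
  where
    a₁≡a : ∀ t → 2 ≤ t → count a₁ t ≡ count a t
    a₁≡a t 2≤t = m+1≡n+1⇒m≡n (subst-summands (count a₁ t) (count a t) (a₁≡ t) (step-on 2≤t) (step-on (≤-trans (n≤1+n 1) 2≤t)))
    flat-a : ∀ t → 2 ≤ t → count a t ≡ count a 2
    flat-a t 2≤t = trans (sym (a₁≡a t 2≤t)) (trans (flat-a₁ t 2≤t) (a₁≡a 2 ≤-refl))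

-- Comparing first rows, the steps at x and at the letters bumped from the first row by 1
-- and by 2 add up to the single step at 2.
Shape12-from-insert12 : ∀ {a b a₁ b₁ a₂ b₂ x mz mz' m₂} → Sorted a → Sorted b → count a 0 ≡ 0 → ColumnStrict a b →
  FirstTight a b x → Row₀Rel a₂ a x → Insertion₂ 1 a b mz a₁ b₁ nothing → Insertion₂ 2 a₁ b₁ mz' a₂ b₂ m₂ → Shape12 a b
Shape12-from-insert12 {a} {b} {a₁} {a₂ = a₂} {x = x} {mz} {mz'} sorted-a sorted-b pos a≺b ft rel₀ (ins₂ bA eA rB) (ins₂ bA₁ eA₁ _)
  with single-step x mz mz' 2 identity
  where
    open ≡-Reasoning
    shuffle₁ : ∀ i c g k l → i + c + (g + (k + l)) ≡ i + (c + g) + l + k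
    shuffle₁ = solve-∀
    shuffle₂ : ∀ p q r → p + q + r ≡ p + r + q
    shuffle₂ = solve-∀
    identity : ∀ t → stepᵐ x t + (stepᵐ mz t + stepᵐ mz' t) ≡ step 2 t
    identity t = +-cancelˡ-≡ (step 1 t + count a t) _ _ (begin
      step 1 t + count a t + (stepᵐ x t + (stepᵐ mz t + stepᵐ mz' t)) ≡⟨ shuffle₁ (step 1 t) (count a t) (stepᵐ x t) (stepᵐ mz t) (stepᵐ mz' t) ⟩
      step 1 t + (count a t + stepᵐ x t) + stepᵐ mz' t + stepᵐ mz t   ≡⟨ cong (λ k → k + stepᵐ mz' t + stepᵐ mz t) (sym (rel₀ t)) ⟩
      count a₂ t + stepᵐ mz' t + stepᵐ mz t                           ≡⟨ cong (_+ stepᵐ mz t) (eA₁ t) ⟩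
      count a₁ t + step 2 t + stepᵐ mz t                              ≡⟨ shuffle₂ (count a₁ t) (step 2 t) (stepᵐ mz t) ⟩
      count a₁ t + stepᵐ mz t + step 2 t                              ≡⟨ cong (_+ step 2 t) (eA t) ⟩
      count a t + step 1 t + step 2 t                                 ≡⟨ cong (_+ step 2 t) (+-comm (count a t) (step 1 t)) ⟩
      step 1 t + count a t + step 2 t                                 ∎)
... | inj₁ (refl , refl , refl) = Shape12-tight-at-2 sorted-a sorted-b pos a≺b ft bA
... | inj₂ (inj₁ (refl , refl , refl)) = Shape12-bump-at-2 sorted-a sorted-b pos a≺b ft bA (proj₁ rB) eA bA₁
... | inj₂ (inj₂ (_ , _ , refl)) = ⊥-elim (<-irrefl refl (proj₁ bA₁))

count-ones-twos-0 : ∀ α β → count (ones-twos α β) 0 ≡ 0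
count-ones-twos-0 α β = trans (count-ones-twos α β 0) (trans (weighted-steps α β (step-off z<s) (step-off z<s)) (cong₂ _+_ (*-zeroʳ α) (*-zeroʳ β)))

count-ones-twos-1 : ∀ α β → count (ones-twos α β) 1 ≡ α
count-ones-twos-1 α β = trans (count-ones-twos α β 1)
  (trans (weighted-steps α β (step-on ≤-refl) (step-off (n<1+n 1))) (trans (cong₂ _+_ (*-identityʳ α) (*-zeroʳ β)) (+-identityʳ α)))

count-ones-twos-≥2 : ∀ α β t → 2 ≤ t → count (ones-twos α β) t ≡ α + β
count-ones-twos-≥2 α β t 2≤t = trans (count-ones-twos α β t)
  (trans (weighted-steps α β (step-on (≤-trans (n≤1+n 1) 2≤t)) (step-on 2≤t)) (cong₂ _+_ (*-identityʳ α) (*-identityʳ β)))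

count-ones-twos≤ : ∀ α β t → count (ones-twos α β) t ≤ α + β
count-ones-twos≤ α β zero = ≤-trans (≤-reflexive (count-ones-twos-0 α β)) z≤n
count-ones-twos≤ α β (suc zero) = ≤-trans (≤-reflexive (count-ones-twos-1 α β)) (m≤m+n α β)
count-ones-twos≤ α β t@(suc (suc _)) = ≤-reflexive (count-ones-twos-≥2 α β t (s≤s (s≤s z≤n)))

count-ones-twos-≥1 : ∀ α β t → 1 ≤ t → α ≤ count (ones-twos α β) t
count-ones-twos-≥1 α β (suc zero) _ = ≤-reflexive (sym (count-ones-twos-1 α β))
count-ones-twos-≥1 α β t@(suc (suc _)) _ = ≤-trans (m≤m+n α β) (≤-reflexive (sym (count-ones-twos-≥2 α β t (s≤s (s≤s z≤n)))))

ones-twos-flat : ∀ α β t → 2 ≤ t → count (ones-twos α β) t ≡ count (ones-twos α β) 2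
ones-twos-flat α β t 2≤t = trans (count-ones-twos-≥2 α β t 2≤t) (sym (count-ones-twos-≥2 α β 2 ≤-refl))

same-count-after : ∀ {r r' z} (d : ℕ) → (∀ t → count r' t + step z t ≡ count r t + step d t) → ∀ t → z ≤ t → d ≤ t → count r' t ≡ count r t
same-count-after {r} {r'} d eq t z≤t d≤t = m+1≡n+1⇒m≡n (subst-summands (count r' t) (count r t) (eq t) (step-on z≤t) (step-on d≤t))

insert12-without-twos : ∀ {s₀ s₁ x a₁ b₁ m₁ a₂ b₂ m₂} α →
  FirstTight (ones-twos α 0) (replicate α 2) x → Row₀Rel s₀ (ones-twos α 0) x → Row₁Rel s₁ (replicate α 2) x → Sorted s₀ → Sorted s₁ →
  InsertRow₂Spec 1 (ones-twos α 0) (replicate α 2) (a₁ , b₁ , m₁) → InsertRow₂Spec 2 a₁ b₁ (a₂ , b₂ , m₂) →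
  s₀ ≡ a₂ × s₁ ≡ b₂ × m₁ ≡ nothing × m₂ ≡ nothing
insert12-without-twos {s₀} {s₁} {x} {a₁} {b₁} {m₁} {a₂} {b₂} {m₂} α ft rel₀ rel₁ sorted-s₀ sorted-s₁
  (_ , _ , mz , ins₂ bA eA rB) (sorted-a₂ , sorted-b₂ , mz' , ins₂ bA₁ eA₁ rB₁)
  with FirstTight-unique a b x (just 2) ft tight-at-2 | Bumps-unique (count a) 1 mz nothing bA flat-a
  where
    a = ones-twos α 0
    b = replicate α 2
    tight-at-2 : FirstTight a b (just 2)
    tight-at-2 = 1 , refl , ≤-refl , trans (count-ones-twos-≥2 0 α 2 ≤-refl) (sym (count-ones-twos-1 α 0)) , λ t 1≤t t<1 → ⊥-elim (<⇒≱ t<1 1≤t)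
    flat-a : ∀ t → 1 ≤ t → count a t ≡ count a 1
    flat-a (suc zero) _ = refl
    flat-a t@(suc (suc _)) _ = trans (count-ones-twos-≥2 α 0 t (s≤s (s≤s z≤n))) (trans (+-identityʳ α) (sym (count-ones-twos-1 α 0)))
... | refl | refl with rB
... | refl , refl with Bumps-unique (count a₁) 2 mz' nothing bA₁ flat-a₁
  where
    a₁≡ : ∀ t → 2 ≤ t → count a₁ t ≡ α + 0 + 1
    a₁≡ t 2≤t = trans (sym (+-identityʳ _)) (trans (eA t) (cong₂ _+_ (count-ones-twos-≥2 α 0 t 2≤t) (step-on (≤-trans (n≤1+n 1) 2≤t))))
    flat-a₁ : ∀ t → 2 ≤ t → count a₁ t ≡ count a₁ 2
    flat-a₁ t 2≤t = trans (a₁≡ t 2≤t) (sym (a₁≡ 2 ≤-refl))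
... | refl with rB₁
... | refl , refl = count-injective sorted-s₀ sorted-a₂ row₀≡ , count-injective sorted-s₁ sorted-b₂ row₁≡ , refl , refl
  where
    open ≡-Reasoning
    a = ones-twos α 0
    b = replicate α 2
    row₀≡ : ∀ t → count s₀ t ≡ count a₂ t
    row₀≡ t = begin
      count s₀ t                         ≡⟨ rel₀ t ⟩
      step 1 t + (count a t + step 2 t)  ≡⟨ sym (+-assoc (step 1 t) _ _) ⟩
      step 1 t + count a t + step 2 t    ≡⟨ cong (_+ step 2 t) (trans (+-comm (step 1 t) (count a t)) (sym (eA t))) ⟩
      count a₁ t + 0 + step 2 t          ≡⟨ cong (_+ step 2 t) (+-identityʳ _) ⟩
      count a₁ t + step 2 t              ≡⟨ sym (eA₁ t) ⟩
      count a₂ t + 0                     ≡⟨ +-identityʳ _ ⟩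
      count a₂ t                         ∎
    row₁≡ : ∀ t → count s₁ t ≡ count b t
    row₁≡ t = +-cancelʳ-≡ (step 2 t) _ _ (rel₁ t)

insert12-with-twos : ∀ {s₀ s₁ x a₁ b₁ m₁ a₂ b₂ m₂} α β γ → γ < α → 1 ≤ β →
  FirstTight (ones-twos α β) (replicate γ 2) x → Row₀Rel s₀ (ones-twos α β) x → Row₁Rel s₁ (replicate γ 2) x → Sorted s₀ → Sorted s₁ →
  InsertRow₂Spec 1 (ones-twos α β) (replicate γ 2) (a₁ , b₁ , m₁) → InsertRow₂Spec 2 a₁ b₁ (a₂ , b₂ , m₂) →
  s₀ ≡ a₂ × s₁ ≡ b₂ × m₁ ≡ nothing × m₂ ≡ nothing
insert12-with-twos {s₀} {s₁} {x} {a₁} {b₁} {m₁} {a₂} {b₂} {m₂} α β γ γ<α 1≤β ft rel₀ rel₁ sorted-s₀ sorted-s₁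
  (_ , _ , mz , ins₂ bA eA rB) (sorted-a₂ , sorted-b₂ , mz' , ins₂ bA₁ eA₁ rB₁)
  with FirstTight-unique a b x nothing ft slack | Bumps-unique (count a) 1 mz (just 2) bA bump-2
  where
    a = ones-twos α β
    b = replicate γ 2
    slack : FirstTight a b nothing
    slack t 1≤t = ≤-<-trans (count-ones-twos≤ 0 γ (suc t)) (<-≤-trans γ<α (count-ones-twos-≥1 α β t 1≤t))
    bump-2 : Bumps (count a) 1 (just 2)
    bump-2 = ≤-refl , (λ t 1≤t t<2 → cong (count a) (≤-antisym (≤-pred t<2) 1≤t))
           , subst₂ _<_ (sym (count-ones-twos-1 α β)) (sym (count-ones-twos-≥2 α β 2 ≤-refl)) (subst (_≤ α + β) (+-comm α 1) (+-monoʳ-≤ α 1≤β))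
... | refl | refl with Bumps-unique (count (replicate γ 2)) 2 m₁ nothing (proj₁ rB) (ones-twos-flat 0 γ)
... | refl with Bumps-unique (count a₁) 2 mz' nothing bA₁ flat-a₁
  where
    a = ones-twos α β
    a₁≡a : ∀ t → 2 ≤ t → count a₁ t ≡ count a t
    a₁≡a t 2≤t = same-count-after 1 eA t 2≤t (≤-trans (n≤1+n 1) 2≤t)
    flat-a₁ : ∀ t → 2 ≤ t → count a₁ t ≡ count a₁ 2
    flat-a₁ t 2≤t = trans (a₁≡a t 2≤t) (trans (ones-twos-flat α β t 2≤t) (sym (a₁≡a 2 ≤-refl)))
... | refl with rB₁
... | refl , refl = count-injective sorted-s₀ sorted-a₂ row₀≡ , count-injective sorted-s₁ sorted-b₂ row₁≡ , refl , refl
  where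
    open ≡-Reasoning
    a = ones-twos α β
    b = replicate γ 2
    row₀≡ : ∀ t → count s₀ t ≡ count a₂ t
    row₀≡ t = begin
      count s₀ t                 ≡⟨ rel₀ t ⟩
      step 1 t + (count a t + 0) ≡⟨ cong (step 1 t +_) (+-identityʳ _) ⟩
      step 1 t + count a t       ≡⟨ +-comm (step 1 t) (count a t) ⟩
      count a t + step 1 t       ≡⟨ sym (eA t) ⟩
      count a₁ t + step 2 t      ≡⟨ sym (eA₁ t) ⟩
      count a₂ t + 0             ≡⟨ +-identityʳ _ ⟩
      count a₂ t                 ∎
    row₁≡ : ∀ t → count s₁ t ≡ count b₁ t
    row₁≡ t = trans (sym (+-identityʳ _)) (trans (rel₁ t) (sym (trans (sym (+-identityʳ _)) (proj₂ rB t))))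

Shape12⇒insert12 : ∀ {a b s₀ s₁ x a₁ b₁ m₁ a₂ b₂ m₂} → Shape12 a b → FirstTight a b x → Row₀Rel s₀ a x → Row₁Rel s₁ b x →
  Sorted s₀ → Sorted s₁ → InsertRow₂Spec 1 a b (a₁ , b₁ , m₁) → InsertRow₂Spec 2 a₁ b₁ (a₂ , b₂ , m₂) →
  s₀ ≡ a₂ × s₁ ≡ b₂ × m₁ ≡ nothing × m₂ ≡ nothing
Shape12⇒insert12 (α , _ , _ , refl , refl , inj₁ (refl , refl)) = insert12-without-twos α
Shape12⇒insert12 (α , β , γ , refl , refl , inj₂ (γ<α , 1≤β)) = insert12-with-twos α β γ γ<α 1≤β

commutes⇒Shape12 : ∀ S T → Invariant S T → S ≡ insert 2 (insert 1 T) → Shape12 (row₀ T) (row₁ T)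
commutes⇒Shape12 S T (_ , ssT , pos , _ , _ , (x , ft , rel₀ , _) , rows≡) S≡
  with insertRow₂ 1 (row₀ T) (row₁ T) in eq₁ | insertRow₂-spec 1 (row₀ T) (row₁ T) (sorted₀ T ssT) (sorted₁ T ssT)
... | (a₁ , b₁ , m₁) | (sorted-a₁ , sorted-b₁ , _ , ins₁)
  with insertRow₂ 2 a₁ b₁ in eq₂ | insertRow₂-spec 2 a₁ b₁ sorted-a₁ sorted-b₁
... | (a₂ , b₂ , m₂) | (_ , _ , _ , ins₁₂)
  with trans (cong split₂ S≡) (split₂-insert² 1 2 T eq₁ eq₂)
... | split≡ with insertᵐ²-fixed⇒nothing m₁ m₂ (rows₂ T) (trans (sym rows≡) (cong (λ p → proj₂ (proj₂ p)) split≡))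
... | refl , refl = Shape12-from-insert12 (sorted₀ T ssT) (sorted₁ T ssT) pos (strict₀₁ T ssT) ft
                      (subst (λ r → Row₀Rel r (row₀ T) x) (cong proj₁ split≡) rel₀) ins₁ ins₁₂

Shape12⇒commutes : ∀ S T → Invariant S T → Shape12 (row₀ T) (row₁ T) → S ≡ insert 2 (insert 1 T)
Shape12⇒commutes S T (ssS , ssT , _ , neS , neT , (x , ft , rel₀ , rel₁) , rows≡) shape
  with insertRow₂ 1 (row₀ T) (row₁ T) in eq₁ | insertRow₂-spec 1 (row₀ T) (row₁ T) (sorted₀ T ssT) (sorted₁ T ssT)
... | (a₁ , b₁ , m₁) | spec₁@(sorted-a₁ , sorted-b₁ , _)
  with insertRow₂ 2 a₁ b₁ in eq₂ | insertRow₂-spec 2 a₁ b₁ sorted-a₁ sorted-b₁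
... | (a₂ , b₂ , m₂) | spec₂
  with Shape12⇒insert12 shape ft rel₀ rel₁ (sorted₀ S ssS) (sorted₁ S ssS) spec₁ spec₂
... | s₀≡ , s₁≡ , refl , refl =
  split₂-injective S (insert 2 (insert 1 T)) neS (NonEmptyRows-insert 2 _ (NonEmptyRows-insert 1 T neT))
    (trans (cong₂ _,_ s₀≡ (cong₂ _,_ s₁≡ rows≡)) (sym (split₂-insert² 1 2 T eq₁ eq₂)))

-- Columns

nth-none : ∀ r j → length r ≤ j → nth r j ≡ nothing
nth-none [] j _ = refl
nth-none (x ∷ r) (suc j) (s≤s r≤j) = nth-none r j r≤j

nth-some : ∀ r j → j < length r → ∃[ v ] nth r j ≡ just v
nth-some (x ∷ r) zero _ = x , refl
nth-some (x ∷ r) (suc j) (s≤s j<r) = nth-some r j j<r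

nth-All : ∀ {P : ℕ → Set} r j {v} → All P r → nth r j ≡ just v → P v
nth-All (x ∷ r) zero (px ∷ _) refl = px
nth-All (x ∷ r) (suc j) (_ ∷ pr) eq = nth-All r j pr eq

nth-length : ∀ r j {v} → nth r j ≡ just v → j < length r
nth-length (x ∷ r) zero _ = s≤s z≤n
nth-length (x ∷ r) (suc j) eq = s≤s (nth-length r j eq)

All-from-nth : ∀ {P : ℕ → Set} r → (∀ j {v} → nth r j ≡ just v → P v) → All P r
All-from-nth [] _ = []
All-from-nth (x ∷ r) p = p zero refl ∷ All-from-nth r (λ j → p (suc j))

nth-replicate : ∀ n v j → j < n → nth (replicate n v) j ≡ just v
nth-replicate (suc n) v zero _ = refl
nth-replicate (suc n) v (suc j) (s≤s j<n) = nth-replicate n v j j<n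

nth-replicate⁻ : ∀ n v j {w} → nth (replicate n v) j ≡ just w → w ≡ v
nth-replicate⁻ (suc n) v zero refl = refl
nth-replicate⁻ (suc n) v (suc j) eq = nth-replicate⁻ n v j eq

length-ones-twos : ∀ α β → length (ones-twos α β) ≡ α + β
length-ones-twos zero β = length-replicate β
length-ones-twos (suc α) β = cong suc (length-ones-twos α β)

nth-ones-twos-1 : ∀ α β j → j < α → nth (ones-twos α β) j ≡ just 1
nth-ones-twos-1 (suc α) β zero _ = refl
nth-ones-twos-1 (suc α) β (suc j) (s≤s j<α) = nth-ones-twos-1 α β j j<α

nth-ones-twos-2 : ∀ α β j → α ≤ j → j < α + β → nth (ones-twos α β) j ≡ just 2
nth-ones-twos-2 zero β j _ j<β = nth-replicate β 2 j j<β
nth-ones-twos-2 (suc α) β (suc j) (s≤s α≤j) (s≤s j<α+β) = nth-ones-twos-2 α β j α≤j j<α+β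

nth-ones-twos⁻ : ∀ α β j {v} → nth (ones-twos α β) j ≡ just v → v ≡ 1 × j < α ⊎ v ≡ 2 × α ≤ j
nth-ones-twos⁻ zero β j eq = inj₂ (nth-replicate⁻ β 2 j eq , z≤n)
nth-ones-twos⁻ (suc α) β zero refl = inj₁ (refl , s≤s z≤n)
nth-ones-twos⁻ (suc α) β (suc j) eq with nth-ones-twos⁻ α β j eq
... | inj₁ (v≡1 , j<α) = inj₁ (v≡1 , s≤s j<α)
... | inj₂ (v≡2 , α≤j) = inj₂ (v≡2 , s≤s α≤j)

All≡2⇒replicate : ∀ r → All (_≡ 2) r → r ≡ replicate (length r) 2
All≡2⇒replicate [] _ = refl
All≡2⇒replicate (x ∷ r) (refl ∷ r≡2) = cong (2 ∷_) (All≡2⇒replicate r r≡2)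

sorted-1-or-2⇒ones-twos : ∀ r → Sorted r → All (λ e → e ≡ 1 ⊎ e ≡ 2) r → ∃[ α ] ∃[ β ] r ≡ ones-twos α β
sorted-1-or-2⇒ones-twos [] _ _ = 0 , 0 , refl
sorted-1-or-2⇒ones-twos (x ∷ r) (_ ∷ sorted) (inj₁ refl ∷ r∈12) with sorted-1-or-2⇒ones-twos r sorted r∈12
... | α , β , r≡ = suc α , β , cong (1 ∷_) r≡
sorted-1-or-2⇒ones-twos (x ∷ r) (2≤r ∷ _) (inj₂ refl ∷ r∈12) = 0 , suc (length r) , cong (2 ∷_) (All≡2⇒replicate r (twos r 2≤r r∈12))
  where
    twos : ∀ r → All (2 ≤_) r → All (λ e → e ≡ 1 ⊎ e ≡ 2) r → All (_≡ 2) r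
    twos [] _ _ = []
    twos (y ∷ r) (s≤s () ∷ _) (inj₁ refl ∷ _)
    twos (y ∷ r) (_ ∷ 2≤r) (inj₂ y≡2 ∷ r∈12) = y≡2 ∷ twos r 2≤r r∈12

UpperEntry : List ℕ → List ℕ → ℕ → Set
UpperEntry r₀ r₁ v = ∃[ j ] length r₁ ≤ j × j < length r₀ × nth r₀ j ≡ just v

-- Conditions (a) and (b) read on the first two rows: column j starts with 1, 2 for
-- j < length r₁, the other columns are [1] or [2], and if there is one then both occur.
record RowCond (r₀ r₁ : List ℕ) : Set where
  field
    lower : ∀ j → j < length r₁ → nth r₀ j ≡ just 1 × nth r₁ j ≡ just 2
    upper : ∀ j → length r₁ ≤ j → j < length r₀ → nth r₀ j ≡ just 1 ⊎ nth r₀ j ≡ just 2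
    both  : length r₁ < length r₀ → UpperEntry r₀ r₁ 1 × UpperEntry r₀ r₁ 2

Shape12⇒RowCond : ∀ {r₀ r₁} → Shape12 r₀ r₁ → RowCond r₀ r₁
Shape12⇒RowCond (α , β , γ , refl , refl , shape) = record { lower = lower ; upper = upper ; both = both shape }
  where
    r₀ = ones-twos α β
    r₁ = replicate γ 2
    n₀≡ : length r₀ ≡ α + β
    n₀≡ = length-ones-twos α β
    n₁≡ : length r₁ ≡ γ
    n₁≡ = length-replicate γ
    γ≤α : γ ≤ α
    γ≤α = [ (λ (γ≡α , _) → ≤-reflexive γ≡α) , (λ (γ<α , _) → <⇒≤ γ<α) ]′ shape
    lower : ∀ j → j < length r₁ → nth r₀ j ≡ just 1 × nth r₁ j ≡ just 2
    lower j j<n₁ = nth-ones-twos-1 α β j (<-≤-trans j<γ γ≤α) , nth-replicate γ 2 j j<γ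
      where j<γ = subst (j <_) n₁≡ j<n₁
    upper : ∀ j → length r₁ ≤ j → j < length r₀ → nth r₀ j ≡ just 1 ⊎ nth r₀ j ≡ just 2
    upper j _ j<n₀ with j <? α
    ... | yes j<α = inj₁ (nth-ones-twos-1 α β j j<α)
    ... | no j≮α = inj₂ (nth-ones-twos-2 α β j (≮⇒≥ j≮α) (subst (j <_) n₀≡ j<n₀))
    both : γ ≡ α × β ≡ 0 ⊎ γ < α × 1 ≤ β → length r₁ < length r₀ → UpperEntry r₀ r₁ 1 × UpperEntry r₀ r₁ 2
    both (inj₁ (refl , refl)) n₁<n₀ = ⊥-elim (<-irrefl (trans n₁≡ (sym (trans n₀≡ (+-identityʳ γ)))) n₁<n₀)
    both (inj₂ (γ<α , 1≤β)) _ =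
      (γ , ≤-reflexive n₁≡ , subst (γ <_) (sym n₀≡) (<-≤-trans γ<α (m≤m+n α β)) , nth-ones-twos-1 α β γ γ<α) ,
      (α , ≤-trans (≤-reflexive n₁≡) γ≤α , subst (α <_) (sym n₀≡) α<α+β , nth-ones-twos-2 α β α ≤-refl α<α+β)
      where
        α<α+β : α < α + β
        α<α+β = subst (_≤ α + β) (+-comm α 1) (+-monoʳ-≤ α 1≤β)

RowCond⇒Shape12 : ∀ {r₀ r₁} → Sorted r₀ → RowCond r₀ r₁ → Shape12 r₀ r₁
RowCond⇒Shape12 {r₀} {r₁} sorted rc with sorted-1-or-2⇒ones-twos r₀ sorted (All-from-nth r₀ entry)
  where
    open RowCond rc
    entry : ∀ j {v} → nth r₀ j ≡ just v → v ≡ 1 ⊎ v ≡ 2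
    entry j eq with j <? length r₁
    ... | yes j<n₁ = inj₁ (just-injective (trans (sym eq) (proj₁ (lower j j<n₁))))
    ... | no j≮n₁ with upper j (≮⇒≥ j≮n₁) (nth-length r₀ j eq)
    ...   | inj₁ eq₁ = inj₁ (just-injective (trans (sym eq) eq₁))
    ...   | inj₂ eq₂ = inj₂ (just-injective (trans (sym eq) eq₂))
... | α , β , r₀≡ = α , β , length r₁ , r₀≡ , r₁≡ , shape
  where
    open RowCond rc
    r₁≡ : r₁ ≡ replicate (length r₁) 2
    r₁≡ = All≡2⇒replicate r₁ (All-from-nth r₁ (λ j eq → just-injective (trans (sym eq) (proj₂ (lower j (nth-length r₁ j eq))))))
    n₀≡ : length r₀ ≡ α + β
    n₀≡ = trans (cong length r₀≡) (length-ones-twos α β)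
    entry⁻ : ∀ j {v} → nth r₀ j ≡ just v → v ≡ 1 × j < α ⊎ v ≡ 2 × α ≤ j
    entry⁻ j eq = nth-ones-twos⁻ α β j (trans (cong (λ r → nth r j) (sym r₀≡)) eq)
    γ≤α : length r₁ ≤ α
    γ≤α with α <? length r₁
    ... | no α≮γ = ≮⇒≥ α≮γ
    ... | yes α<γ with entry⁻ α (proj₁ (lower α α<γ))
    ...   | inj₁ (_ , α<α) = ⊥-elim (<-irrefl refl α<α)
    ...   | inj₂ (1≡2 , _) = ⊥-elim (1+n≢n (sym 1≡2))
    shape : length r₁ ≡ α × β ≡ 0 ⊎ length r₁ < α × 1 ≤ β
    shape with length r₁ <? length r₀
    ... | no γ≮n₀ = inj₁ (≤-antisym γ≤α (≤-trans (m≤m+n α β) n₀≤γ) , n≤0⇒n≡0 (+-cancelˡ-≤ α β 0 (≤-trans n₀≤γ (≤-trans γ≤α (≤-reflexive (sym (+-identityʳ α)))))))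
      where n₀≤γ = subst (_≤ length r₁) n₀≡ (≮⇒≥ γ≮n₀)
    ... | yes γ<n₀ with both γ<n₀
    ...   | (j₁ , γ≤j₁ , _ , eq₁) , (j₂ , _ , j₂<n₀ , eq₂) = inj₂ (γ<α (entry⁻ j₁ eq₁) , 1≤β (entry⁻ j₂ eq₂))
      where
        γ<α : _ → length r₁ < α
        γ<α (inj₁ (_ , j₁<α)) = ≤-<-trans γ≤j₁ j₁<α
        γ<α (inj₂ (1≡2 , _)) = ⊥-elim (1+n≢n (sym 1≡2))
        1≤β : _ → 1 ≤ β
        1≤β (inj₁ (2≡1 , _)) = ⊥-elim (1+n≢n 2≡1)
        1≤β (inj₂ (_ , α≤j₂)) = n≢0⇒n>0 λ β≡0 → <⇒≱ (subst (j₂ <_) (trans n₀≡ (trans (cong (α +_) β≡0) (+-identityʳ α))) j₂<n₀) α≤j₂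

All≤sum : ∀ r → All (_≤ sum r) r
All≤sum [] = []
All≤sum (x ∷ r) = m≤m+n x (sum r) ∷ All.map (λ p → ≤-trans p (m≤n+m (sum r) x)) (All≤sum r)

ColumnStrict⇒length≤ : ∀ r s → ColumnStrict r s → length s ≤ length r
ColumnStrict⇒length≤ r s r≺s = subst₂ _≤_
  (count-All≤ s (All.map (λ p → ≤-trans p (≤-trans (m≤n+m (sum s) (sum r)) (n≤1+n _))) (All≤sum s)))
  (count-All≤ r (All.map (λ p → ≤-trans p (m≤m+n (sum r) (sum s))) (All≤sum r)))
  (r≺s (sum r + sum s))

rows-below-count≡0 : ∀ k s rs → Semistandard (s ∷ rs) → count s k ≡ 0 → All (λ r → count r (suc k) ≡ 0) rs
rows-below-count≡0 k s [] _ _ = []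
rows-below-count≡0 k s (r ∷ rs) (_ , s≺r , ss) s≡0 =
  r≡0 ∷ All.map (λ {r'} r'≡0 → n≤0⇒n≡0 (≤-trans (count-mono r' (n≤1+n (suc k))) (≤-reflexive r'≡0))) (rows-below-count≡0 (suc k) r rs ss r≡0)
  where
    r≡0 : count r (suc k) ≡ 0
    r≡0 = n≤0⇒n≡0 (≤-trans (s≺r k) (≤-reflexive s≡0))

rows-below-shorter : ∀ s rs → Semistandard (s ∷ rs) → All (λ r → length r ≤ length s) rs
rows-below-shorter s [] _ = []
rows-below-shorter s (r ∷ rs) (_ , s≺r , ss) =
  ColumnStrict⇒length≤ s r s≺r ∷ All.map (λ r'≤r → ≤-trans r'≤r (ColumnStrict⇒length≤ s r s≺r)) (rows-below-shorter r rs ss)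

record ColumnFacts (T : Tableau) : Set where
  field
    row₁≥2     : All (2 ≤_) (row₁ T)
    rows₂≥3    : All (All (3 ≤_)) (rows₂ T)
    row₁≤row₀  : length (row₁ T) ≤ length (row₀ T)
    rows₂≤row₁ : All (λ r → length r ≤ length (row₁ T)) (rows₂ T)

column-facts : ∀ T → Semistandard T → Positive T → ColumnFacts T
column-facts [] _ _ = record { row₁≥2 = [] ; rows₂≥3 = [] ; row₁≤row₀ = z≤n ; rows₂≤row₁ = [] }
column-facts (r ∷ []) _ _ = record { row₁≥2 = [] ; rows₂≥3 = [] ; row₁≤row₀ = z≤n ; rows₂≤row₁ = [] }
column-facts (r ∷ s ∷ rs) (_ , r≺s , ss) pos = record
  { row₁≥2 = count≡0⇒All> s s≡0
  ; rows₂≥3 = All.map (λ {r'} r'≡0 → count≡0⇒All> r' r'≡0) (rows-below-count≡0 1 s rs ss s≡0)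
  ; row₁≤row₀ = ColumnStrict⇒length≤ r s r≺s
  ; rows₂≤row₁ = rows-below-shorter s rs ss
  }
  where
    s≡0 : count s 1 ≡ 0
    s≡0 = n≤0⇒n≡0 (≤-trans (r≺s 0) (≤-reflexive pos))

mapMaybe-nth-none : ∀ j rs → All (λ r → length r ≤ j) rs → mapMaybe (λ r → nth r j) rs ≡ []
mapMaybe-nth-none j [] _ = refl
mapMaybe-nth-none j (r ∷ rs) (r≤j ∷ rs≤j) rewrite nth-none r j r≤j = mapMaybe-nth-none j rs rs≤j

mapMaybe-nth-All : ∀ {P : ℕ → Set} j rs → All (All P) rs → All P (mapMaybe (λ r → nth r j) rs)
mapMaybe-nth-All j [] _ = []
mapMaybe-nth-All j (r ∷ rs) (pr ∷ prs) with nth r j in eq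
... | just v = nth-All r j pr eq ∷ mapMaybe-nth-All j rs prs
... | nothing = mapMaybe-nth-All j rs prs

column-rows : ∀ T j → column T j ≡ mapMaybe (λ r → nth r j) (row₀ T ∷ row₁ T ∷ rows₂ T)
column-rows [] j = refl
column-rows (r ∷ []) j = refl
column-rows (r ∷ s ∷ rs) j = refl

data ColumnView (T : Tableau) (j : ℕ) : Set where
  tall   : ∀ {v₀ v₁ M} → j < length (row₁ T) → nth (row₀ T) j ≡ just v₀ → nth (row₁ T) j ≡ just v₁ →
           2 ≤ v₁ → All (3 ≤_) M → column T j ≡ v₀ ∷ v₁ ∷ M → ColumnView T j
  single : ∀ {v₀} → length (row₁ T) ≤ j → nth (row₀ T) j ≡ just v₀ → column T j ≡ v₀ ∷ [] → ColumnView T j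

column-view : ∀ T → ColumnFacts T → ∀ j → j < length (row₀ T) → ColumnView T j
column-view T facts j j<n₀ with j <? length (row₁ T) | nth-some (row₀ T) j j<n₀
... | no j≮n₁ | v₀ , e₀ = single (≮⇒≥ j≮n₁) e₀ column≡
  where
    open ColumnFacts facts
    column≡ : column T j ≡ v₀ ∷ []
    column≡ rewrite column-rows T j | e₀ | nth-none (row₁ T) j (≮⇒≥ j≮n₁)
                  | mapMaybe-nth-none j (rows₂ T) (All.map (λ r≤n₁ → ≤-trans r≤n₁ (≮⇒≥ j≮n₁)) rows₂≤row₁) = refl
... | yes j<n₁ | v₀ , e₀ with nth-some (row₁ T) j j<n₁
...   | v₁ , e₁ = tall j<n₁ e₀ e₁ (nth-All (row₁ T) j row₁≥2 e₁) (mapMaybe-nth-All j (rows₂ T) rows₂≥3) column≡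
  where
    open ColumnFacts facts
    column≡ : column T j ≡ v₀ ∷ v₁ ∷ mapMaybe (λ r → nth r j) (rows₂ T)
    column≡ rewrite column-rows T j | e₀ | e₁ = refl

firstRowLength≡ : ∀ T → firstRowLength T ≡ length (row₀ T)
firstRowLength≡ [] = refl
firstRowLength≡ (r ∷ _) = refl

column∈columns : ∀ T j → j < length (row₀ T) → column T j ∈ columns T
column∈columns T j j<n₀ = ∈-map⁺ (column T) (∈-upTo⁺ (subst (j <_) (sym (firstRowLength≡ T)) j<n₀))

∈columns⇒column : ∀ T c → c ∈ columns T → ∃[ j ] j < length (row₀ T) × c ≡ column T j
∈columns⇒column T c c∈ with ∈-map⁻ (column T) c∈
... | j , j∈ , refl = j , subst (j <_) (firstRowLength≡ T) (∈-upTo⁻ j∈) , refl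

module _ (T : Tableau) (facts : ColumnFacts T) where
  open ColumnFacts facts

  private
    r₀ = row₀ T
    r₁ = row₁ T

  singleton-column⇒UpperEntry : ∀ {v} → (v ∷ []) ∈ columns T → UpperEntry r₀ r₁ v
  singleton-column⇒UpperEntry {v} v∈ with ∈columns⇒column T (v ∷ []) v∈
  ... | j , j<n₀ , v≡ with column-view T facts j j<n₀
  ...   | tall _ _ _ _ _ c≡ = ⊥-elim (1+n≢0 (suc-injective (cong length (trans (sym c≡) (sym v≡)))))
  ...   | single n₁≤j e₀ c≡ = j , n₁≤j , j<n₀ , trans e₀ (cong just (∷-injectiveˡ (trans (sym c≡) (sym v≡))))

  UpperEntry⇒singleton-column : ∀ {v} → UpperEntry r₀ r₁ v → (v ∷ []) ∈ columns T
  UpperEntry⇒singleton-column (j , n₁≤j , j<n₀ , e) with column-view T facts j j<n₀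
  ... | tall j<n₁ _ _ _ _ _ = ⊥-elim (<⇒≱ j<n₁ n₁≤j)
  ... | single _ e₀ c≡ = subst (_∈ columns T) (trans c≡ (cong (_∷ []) (just-injective (trans (sym e₀) e)))) (column∈columns T j j<n₀)

  Conds⇒RowCond : CondA T → CondB T → RowCond r₀ r₁
  Conds⇒RowCond (singletons , both-singletons) tall-columns = record { lower = lower ; upper = upper ; both = both }
    where
      lower : ∀ j → j < length r₁ → nth r₀ j ≡ just 1 × nth r₁ j ≡ just 2
      lower j j<n₁ with column-view T facts j (<-≤-trans j<n₁ row₁≤row₀)
      ... | single n₁≤j _ _ = ⊥-elim (<⇒≱ j<n₁ n₁≤j)
      ... | tall {v₀} {v₁} {M} _ e₀ e₁ 2≤v₁ M≥3 c≡
        with tall-columns (column T j) (column∈columns T j (<-≤-trans j<n₁ row₁≤row₀)) (subst (λ c → 2 ≤ length c) (sym c≡) (s≤s (s≤s z≤n)))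
      ...   | 1∈ , 2∈ = trans e₀ (cong just v₀≡1) , trans e₁ (cong just v₁≡2)
        where
          v₀≡1 : v₀ ≡ 1
          v₀≡1 with subst (1 ∈_) c≡ 1∈
          ... | here 1≡v₀ = sym 1≡v₀
          ... | there (here refl) = ⊥-elim (<-irrefl refl 2≤v₁)
          ... | there (there 1∈M) = ⊥-elim (<⇒≱ (All.lookup M≥3 1∈M) (s≤s z≤n))
          v₁≡2 : v₁ ≡ 2
          v₁≡2 with subst (2 ∈_) c≡ 2∈
          ... | here 2≡v₀ = ⊥-elim (1+n≢n (trans 2≡v₀ v₀≡1))
          ... | there (here 2≡v₁) = sym 2≡v₁
          ... | there (there 2∈M) = ⊥-elim (<-irrefl refl (All.lookup M≥3 2∈M))
      upper : ∀ j → length r₁ ≤ j → j < length r₀ → nth r₀ j ≡ just 1 ⊎ nth r₀ j ≡ just 2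
      upper j n₁≤j j<n₀ with column-view T facts j j<n₀
      ... | tall j<n₁ _ _ _ _ _ = ⊥-elim (<⇒≱ j<n₁ n₁≤j)
      ... | single _ e₀ c≡ with singletons (column T j) (column∈columns T j j<n₀) (cong length c≡)
      ...   | inj₁ c≡1 = inj₁ (trans e₀ (cong just (∷-injectiveˡ (trans (sym c≡) c≡1))))
      ...   | inj₂ c≡2 = inj₂ (trans e₀ (cong just (∷-injectiveˡ (trans (sym c≡) c≡2))))
      both : length r₁ < length r₀ → UpperEntry r₀ r₁ 1 × UpperEntry r₀ r₁ 2
      both n₁<n₀ with column-view T facts (length r₁) n₁<n₀
      ... | tall n₁<n₁ _ _ _ _ _ = ⊥-elim (<-irrefl refl n₁<n₁)
      ... | single _ _ c≡ with both-singletons (column T (length r₁) , column∈columns T (length r₁) n₁<n₀ , cong length c≡)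
      ...   | 1∈ , 2∈ = singleton-column⇒UpperEntry 1∈ , singleton-column⇒UpperEntry 2∈

  RowCond⇒Conds : RowCond r₀ r₁ → CondA T × CondB T
  RowCond⇒Conds rc = (singletons , both-singletons) , tall-columns
    where
      open RowCond rc
      tall-columns : CondB T
      tall-columns c c∈ 2≤c with ∈columns⇒column T c c∈
      ... | j , j<n₀ , refl with column-view T facts j j<n₀
      ...   | single _ _ c≡ = ⊥-elim (2≰1 (subst (λ c → 2 ≤ length c) c≡ 2≤c))
      ...   | tall j<n₁ e₀ e₁ _ _ c≡ with lower j j<n₁
      ...     | e₀' , e₁' rewrite c≡ | just-injective (trans (sym e₀) e₀') | just-injective (trans (sym e₁) e₁') = here refl , there (here refl)
      singletons : ∀ c → c ∈ columns T → length c ≡ 1 → c ≡ 1 ∷ [] ⊎ c ≡ 2 ∷ []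
      singletons c c∈ c≡1 with ∈columns⇒column T c c∈
      ... | j , j<n₀ , refl with column-view T facts j j<n₀
      ...   | tall _ _ _ _ _ c≡ = ⊥-elim (1+n≢0 (suc-injective (trans (sym (cong length c≡)) c≡1)))
      ...   | single n₁≤j e₀ c≡ with upper j n₁≤j j<n₀
      ...     | inj₁ e = inj₁ (trans c≡ (cong (_∷ []) (just-injective (trans (sym e₀) e))))
      ...     | inj₂ e = inj₂ (trans c≡ (cong (_∷ []) (just-injective (trans (sym e₀) e))))
      both-singletons : (∃[ c ] c ∈ columns T × length c ≡ 1) → (1 ∷ []) ∈ columns T × (2 ∷ []) ∈ columns T
      both-singletons (c , c∈ , c≡1) with ∈columns⇒column T c c∈
      ... | j , j<n₀ , refl with column-view T facts j j<n₀
      ...   | tall _ _ _ _ _ c≡ = ⊥-elim (1+n≢0 (suc-injective (trans (sym (cong length c≡)) c≡1)))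
      ...   | single n₁≤j _ _ with both (≤-<-trans n₁≤j j<n₀)
      ...     | e₁ , e₂ = UpperEntry⇒singleton-column e₁ , UpperEntry⇒singleton-column e₂

theorem3p4 : (w : Word) → All (1 ≤_) w →
    ((1 ∷ 2 ∷ w) ≡K (w ++ 1 ∷ 2 ∷ [])) ⇔ (CondA (P w) × CondB (P w))
theorem3p4 w 1≤w = mk⇔
  (λ 12w≡w12 → RowCond⇒Conds T facts (Shape12⇒RowCond (commutes⇒Shape12 S T inv (trans 12w≡w12 P-w12))))
  (λ (condA , condB) → trans (Shape12⇒commutes S T inv (RowCond⇒Shape12 (sorted₀ T ssT) (Conds⇒RowCond T facts condA condB))) (sym P-w12))
  where
    S = P (1 ∷ 2 ∷ w)
    T = P w
    inv : Invariant S T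
    inv = Invariant-P w 1≤w
    ssT : Semistandard T
    ssT = proj₁ (proj₂ inv)
    facts : ColumnFacts T
    facts = column-facts T ssT (proj₁ (proj₂ (proj₂ inv)))
    P-w12 : P (w ++ 1 ∷ 2 ∷ []) ≡ insert 2 (insert 1 T)
    P-w12 = foldl-++ (λ U x → insert x U) [] w (1 ∷ 2 ∷ [])
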